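{- For every hypergraph $H$ there is a function $\gamma:\mathcal{Q}(\mathcal{S}(H))\to\mathbb{Q}$ such that for all hypergraphs $G$, $$\#\mathrm{StrEmb}(H,G)=\sum_{F\in\mathcal{Q}(\mathcal{S}(H))}\gamma(F)\cdot\#\mathrm{Hom}(F,G),$$ where $\gamma(F)\ne0$ for every $F\in\mathcal{S}(H)$.
   Context: A hypergraph is a pair $H=(V,E)$ with $V$ finite and $E\subseteq2^V\setminus\{\varnothing\}$. A homomorphism $F\to G$ is a map $\varphi:V(F)\to V(G)$ with $\varphi(e)\in E(G)$ for all $e\in E(F)$; $\mathrm{Hom}(F,G)$ is their set. A strong embedding of $H$ into $G$ is an injective homomorphism $\varphi$ such that for every $S\subseteq V(H)$, $S\in E(H)$ iff $\varphi(S)\in E(G)$; $\mathrm{StrEmb}(H,G)$ is their set. $\mathcal{S}(H)$ is the set of edge-super-hypergraphs $(V(H),E')$ with $E(H)\subseteq E'$. For a partition $\tau$ of $V$ and $X\subseteq V$, $X/\tau:=\{B\in\tau:B\cap X\neq\varnothing\}$ and $H/\tau:=(\tau,\{e/\tau:e\in E\})$; $\mathcal{Q}(\mathcal{S}(H))$ is the set of (isomorphism types of) quotients of members of $\mathcal{S}(H)$. -}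

module Defs where

open import Data.Nat using (ℕ; zero; suc)
open import Data.Bool using (Bool; true; false; _∧_; _∨_; not; if_then_else_)
open import Data.Fin using (Fin; zero; suc)
import Data.Fin as Fin
open import Data.Vec using (Vec; []; _∷_; tabulate; lookup; replicate)
open import Data.List using (List; []; _∷_; map; concatMap; allFin; length)
open import Data.Product using (Σ; ∃; ∃-syntax; _×_; _,_)
open import Data.Integer using (+_)
open import Data.Rational using (ℚ; 0ℚ; _+_; _*_; _/_)
open import Relation.Nullary using (does)
open import Relation.Binary.PropositionalEquality using (_≡_; refl)
open import Function.Definitions using (Bijective; Surjective)
open import Data.Fin.Subset using (Subset; ⊥)

anyFin : ∀ {n} → (Fin n → Bool) → Bool
anyFin {zero}  p = false
anyFin {suc n} p = p zero ∨ anyFin (λ i → p (suc i))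

allFinB : ∀ {n} → (Fin n → Bool) → Bool
allFinB {zero}  p = true
allFinB {suc n} p = p zero ∧ allFinB (λ i → p (suc i))

allVecs : ∀ {A : Set} → List A → (n : ℕ) → List (Vec A n)
allVecs xs zero    = [] ∷ []
allVecs xs (suc n) = concatMap (λ x → map (x ∷_) (allVecs xs n)) xs

allL : ∀ {A : Set} → (A → Bool) → List A → Bool
allL p []       = true
allL p (x ∷ xs) = p x ∧ allL p xs

anyL : ∀ {A : Set} → (A → Bool) → List A → Bool
anyL p []       = false
anyL p (x ∷ xs) = p x ∨ anyL p xs

allSubsets : (n : ℕ) → List (Subset n)
allSubsets n = allVecs (true ∷ false ∷ []) n

allSubsetsB : ∀ {n} → (Subset n → Bool) → Bool
allSubsetsB {n} p = allL p (allSubsets n)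

anySubsetsB : ∀ {n} → (Subset n → Bool) → Bool
anySubsetsB {n} p = anyL p (allSubsets n)

allMaps : (m k : ℕ) → List (Fin m → Fin k)
allMaps m k = map lookup (allVecs (allFin k) m)

count : ∀ {A : Set} → (A → Bool) → List A → ℕ
count p []       = 0
count p (x ∷ xs) = if p x then suc (count p xs) else count p xs

_==ᶠ_ : ∀ {n} → Fin n → Fin n → Bool
i ==ᶠ j = does (i Fin.≟ j)

_==ˢ_ : ∀ {n} → Subset n → Subset n → Bool
_==ˢ_ {n} S T = allFinB (λ i → does (lookup S i Data.Bool.≟ lookup T i))

nonemptyB : ∀ {n} → Subset n → Bool
nonemptyB S = anyFin (lookup S)

_⇒ᵇ_ : Bool → Bool → Bool
a ⇒ᵇ b = not a ∨ b

_⇔ᵇ_ : Bool → Bool → Bool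
a ⇔ᵇ b = does (a Data.Bool.≟ b)

image : ∀ {m k} → (Fin m → Fin k) → Subset m → Subset k
image φ S = tabulate (λ j → anyFin (λ i → lookup S i ∧ (φ i ==ᶠ j)))

record Hypergraph : Set where
  constructor hypergraph
  field
    size    : ℕ
    edge    : Subset size → Bool
    noEmpty : edge ⊥ ≡ false
open Hypergraph public

isHom : (F G : Hypergraph) → (Fin (size F) → Fin (size G)) → Bool
isHom F G φ = allSubsetsB (λ S → edge F S ⇒ᵇ edge G (image φ S))

injectiveB : ∀ {m k} → (Fin m → Fin k) → Bool
injectiveB φ = allFinB (λ i → allFinB (λ j → (φ i ==ᶠ φ j) ⇒ᵇ (i ==ᶠ j)))

isStrEmb : (H G : Hypergraph) → (Fin (size H) → Fin (size G)) → Bool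
isStrEmb H G φ = injectiveB φ ∧ isHom H G φ
               ∧ allSubsetsB (λ S → edge H S ⇔ᵇ edge G (image φ S))

#Hom : Hypergraph → Hypergraph → ℕ
#Hom F G = count (isHom F G) (allMaps (size F) (size G))

#StrEmb : Hypergraph → Hypergraph → ℕ
#StrEmb H G = count (isStrEmb H G) (allMaps (size H) (size G))

_≅_ : Hypergraph → Hypergraph → Set
F ≅ G = Σ (Fin (size F) → Fin (size G)) λ φ →
          Bijective _≡_ _≡_ φ × (∀ S → edge F S ≡ edge G (image φ S))

-- Edge-super-hypergraphs S(H): (V(H), E') with E(H) ⊆ E'

IsSuperEdges : (H : Hypergraph) → (Subset (size H) → Bool) → Set
IsSuperEdges H e = (e ⊥ ≡ false) × (∀ S → edge H S ≡ true → e S ≡ true)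

superHG : (H : Hypergraph) (e : Subset (size H) → Bool) → IsSuperEdges H e → Hypergraph
superHG H e (z , _) = hypergraph (size H) e z

-- A partition τ of Fin n into k blocks is encoded by a
-- surjective block-labelling p : Fin n → Fin k (blocks = fibres of p).
-- Then e/τ corresponds to image p e, and H/τ has vertex set Fin k and
-- edges { image p e : e ∈ E(H) }.

nonemptyB-⊥ : ∀ n → nonemptyB (⊥ {n}) ≡ false
nonemptyB-⊥ zero    = refl
nonemptyB-⊥ (suc n) = nonemptyB-⊥ n

quotEdge : (H : Hypergraph) {k : ℕ} → (Fin (size H) → Fin k) → Subset k → Bool
quotEdge H p T = nonemptyB T ∧ anySubsetsB (λ S → edge H S ∧ (image p S ==ˢ T))

quotEdge-⊥ : (H : Hypergraph) {k : ℕ} (p : Fin (size H) → Fin k) → quotEdge H p ⊥ ≡ false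
quotEdge-⊥ H {k} p rewrite nonemptyB-⊥ k = refl

quotient : (H : Hypergraph) {k : ℕ} → (Fin (size H) → Fin k) → Hypergraph
quotient H {k} p = hypergraph k (quotEdge H p) (quotEdge-⊥ H p)

-- F is (isomorphic to) a member of Q(S(H))
InQS : Hypergraph → Hypergraph → Set
InQS H F = Σ (Subset (size H) → Bool) λ e → Σ (IsSuperEdges H e) λ sup →
             ∃[ k ] Σ (Fin (size H) → Fin k) λ p →
               Surjective _≡_ _≡_ p × (F ≅ quotient (superHG H e sup) p)

-- L : Fin r → Hypergraph is a system of representatives of the
-- isomorphism types in Q(S(H)) (each type exactly once).
IsRepSystem : (H : Hypergraph) (r : ℕ) → (Fin r → Hypergraph) → Set
IsRepSystem H r L = (∀ i → InQS H (L i))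
                  × (∀ i j → L i ≅ L j → i ≡ j)
                  × (∀ F → InQS H F → ∃[ i ] (F ≅ L i))

ℕ→ℚ : ℕ → ℚ
ℕ→ℚ n = (+ n) / 1

sumℚ : ∀ {r} → (Fin r → ℚ) → ℚ
sumℚ {zero}  f = 0ℚ
sumℚ {suc r} f = f zero + sumℚ (λ i → f (suc i))

{-# OPTIONS --safe #-}
-- A strong embedding of H into G is an injective homomorphism that maps no non-edge of H onto an
-- edge of G. Inclusion–exclusion over those non-edges gives
--   #StrEmb(H, G) = Σ_{E′ ⊇ E(H)} (−1)^(|E′| − |E(H)|) #Inj((V, E′), G).
-- Deletion–contraction over the pairs of vertices writes #Inj(F, G) as #Hom(F, G) plus a rational
-- combination of #Hom(F/τ, G) over partitions τ with fewer blocks, with coefficients that depend only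
-- on |V|. Collecting terms by isomorphism type gives γ. A member F of S(H) can only be matched by
-- unquotiented terms, since all the others have fewer vertices; these all carry the sign
-- (−1)^(|E(F)| − |E(H)|) and F occurs among them, so γ(F) is a nonzero integer.
module Submission where

open import Defs
open import Data.Nat using (ℕ)
open import Data.Fin using (Fin)
open import Data.Fin.Subset using (Subset)
open import Data.Bool using (Bool)
open import Data.Product using (Σ; _×_)
open import Data.Rational using (ℚ; 0ℚ; _*_)
open import Relation.Binary.PropositionalEquality using (_≡_; _≢_)

open import Data.Nat as ℕ using (zero; suc; _<_; _≤_)
import Data.Nat.Properties as ℕₚ
open import Data.Bool using (true; false; _∧_; _∨_; not; if_then_else_)
import Data.Bool.Properties as Boolₚ
open import Data.Fin as Fin using (zero; suc; punchIn; punchOut)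
import Data.Fin.Properties as Finₚ
open import Data.Fin.Subset using () renaming (⊥ to ∅)
open import Data.Vec using (Vec; []; _∷_; lookup; tabulate)
import Data.Vec.Properties as Vecₚ
open import Data.List as List using (List; []; _∷_; _++_; map; concatMap; allFin)
open import Data.Nat.ListAction using (sum)
import Data.List.Properties as Listₚ
open import Data.List.Membership.Propositional using (_∈_)
import Data.List.Membership.Propositional.Properties as ∈ₚ
open import Data.List.Relation.Unary.Any as Any using (Any; here; there)
open import Data.List.Relation.Unary.All as All using (All; []; _∷_)
import Data.List.Relation.Unary.All.Properties as Allₚ
import Data.List.Relation.Unary.Any.Properties as Anyₚ
open import Data.List.Relation.Unary.Unique.Propositional using (Unique)
open import Data.List.Relation.Unary.AllPairs using ([]; _∷_)
open import Data.Product using (∃-syntax; _,_; proj₁; proj₂)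
open import Data.Sum as Sum using (_⊎_; inj₁; inj₂)
open import Data.Empty using (⊥-elim)
open import Function using (_∘_; id; mk⇔)
import Function.Construct.Identity as Identity
open import Function.Definitions using (Surjective)
import Function.Construct.Composition as Composition
open import Relation.Nullary using (Dec; yes; no; does)
open import Relation.Nullary.Decidable using (dec-true; dec-false; does-⇔)
open import Relation.Binary.Definitions using (DecidableEquality)
import Data.Integer as ℤ
import Data.Integer.Properties as ℤₚ
open import Data.Rational using (1ℚ; _+_; -_; mkℚ)
import Data.Rational.Properties as ℚₚ
import Data.Nat.Coprimality as Coprimality
import Algebra.Properties.Group ℚₚ.+-0-group as ℚ+Group
import Algebra.Properties.CommutativeSemigroup ℕₚ.+-commutativeSemigroup as ℕ+
import Algebra.Properties.CommutativeMonoid.Sum ℚₚ.+-0-commutativeMonoid as FinSum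
open import Data.Bool.Solver using (module ∨-∧-Solver)
import Data.Rational.Solver as ℚSolver
open import Relation.Binary.PropositionalEquality
  using (refl; sym; trans; cong; cong₂; subst; _≗_; module ≡-Reasoning)

≡true-ext : ∀ {b c : Bool} → (b ≡ true → c ≡ true) → (c ≡ true → b ≡ true) → b ≡ c
≡true-ext {true}  {true}  _ _ = refl
≡true-ext {true}  {false} f _ = sym (f refl)
≡true-ext {false} {true}  _ g = g refl
≡true-ext {false} {false} _ _ = refl

∧-intro : ∀ {a b} → a ≡ true → b ≡ true → a ∧ b ≡ true
∧-intro refl refl = refl

⇒ᵇ-elim : ∀ {a b} → (a ⇒ᵇ b) ≡ true → a ≡ true → b ≡ true
⇒ᵇ-elim h refl = h

⇒ᵇ-intro : ∀ {a b} → (a ≡ true → b ≡ true) → (a ⇒ᵇ b) ≡ true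
⇒ᵇ-intro {true}  f = f refl
⇒ᵇ-intro {false} _ = refl

does⇒ : ∀ {P : Set} (P? : Dec P) → does P? ≡ true → P
does⇒ (yes p) _ = p

==ᶠ⇒≡ : ∀ {n} {i j : Fin n} → (i ==ᶠ j) ≡ true → i ≡ j
==ᶠ⇒≡ {i = i} {j} = does⇒ (i Fin.≟ j)

==ᶠ-refl : ∀ {n} (i : Fin n) → (i ==ᶠ i) ≡ true
==ᶠ-refl i = dec-true (i Fin.≟ i) refl

≢⇒==ᶠ-false : ∀ {n} {i j : Fin n} → i ≢ j → (i ==ᶠ j) ≡ false
≢⇒==ᶠ-false {i = i} {j} = dec-false (i Fin.≟ j)

∨-⇒ᵇ : ∀ a b c → ((a ∨ b) ⇒ᵇ c) ≡ (a ⇒ᵇ c) ∧ (b ⇒ᵇ c)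
∨-⇒ᵇ false false c = refl
∨-⇒ᵇ false true  c = refl
∨-⇒ᵇ true  false c = sym (Boolₚ.∧-identityʳ c)
∨-⇒ᵇ true  true  c = sym (Boolₚ.∧-idem c)

⇔ᵇ-as-⇒ᵇ : ∀ a b → (a ⇔ᵇ b) ≡ (a ⇒ᵇ b) ∧ (b ⇒ᵇ a)
⇔ᵇ-as-⇒ᵇ false false = refl
⇔ᵇ-as-⇒ᵇ false true  = refl
⇔ᵇ-as-⇒ᵇ true  false = refl
⇔ᵇ-as-⇒ᵇ true  true  = refl

anyFin⁺ : ∀ {n} {p : Fin n → Bool} (i : Fin n) → p i ≡ true → anyFin p ≡ true
anyFin⁺ {suc n} {p} zero    h rewrite h = refl
anyFin⁺ {suc n} {p} (suc i) h with p zero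
... | true  = refl
... | false = anyFin⁺ i h

anyFin⁻ : ∀ {n} {p : Fin n → Bool} → anyFin p ≡ true → ∃[ i ] p i ≡ true
anyFin⁻ {suc n} {p} h with p zero in p0
... | true  = zero , p0
... | false = let i , pi = anyFin⁻ h in suc i , pi

anyFin-cong : ∀ {n} {p q : Fin n → Bool} → p ≗ q → anyFin p ≡ anyFin q
anyFin-cong {zero}  _   = refl
anyFin-cong {suc n} p≗q = cong₂ _∨_ (p≗q zero) (anyFin-cong (p≗q ∘ suc))

allFinB⁺ : ∀ {n} {p : Fin n → Bool} → (∀ i → p i ≡ true) → allFinB p ≡ true
allFinB⁺ {zero}  _ = refl
allFinB⁺ {suc n} h = ∧-intro (h zero) (allFinB⁺ (h ∘ suc))

allFinB⁻ : ∀ {n} {p : Fin n → Bool} → allFinB p ≡ true → ∀ i → p i ≡ true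
allFinB⁻ {suc n} {p} h zero    = Boolₚ.∧-conicalˡ (p zero) _ h
allFinB⁻ {suc n} {p} h (suc i) = allFinB⁻ (Boolₚ.∧-conicalʳ (p zero) _ h) i

module _ {A : Set} where

  allL⁺ : ∀ {p : A → Bool} xs → (∀ {x} → x ∈ xs → p x ≡ true) → allL p xs ≡ true
  allL⁺ []       _ = refl
  allL⁺ (x ∷ xs) h = ∧-intro (h (here refl)) (allL⁺ xs (h ∘ there))

  allL⁻ : ∀ {p : A → Bool} {xs} → allL p xs ≡ true → ∀ {x} → x ∈ xs → p x ≡ true
  allL⁻ {p} {y ∷ _} h (here refl) = Boolₚ.∧-conicalˡ (p y) _ h
  allL⁻ {p} {y ∷ _} h (there x∈) = allL⁻ (Boolₚ.∧-conicalʳ (p y) _ h) x∈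

  allL-cong : ∀ {p q : A → Bool} {xs} → All (λ x → p x ≡ q x) xs → allL p xs ≡ allL q xs
  allL-cong []         = refl
  allL-cong (px ∷ pxs) = cong₂ _∧_ px (allL-cong pxs)

  allL-∧ : ∀ (p q : A → Bool) xs → allL (λ x → p x ∧ q x) xs ≡ allL p xs ∧ allL q xs
  allL-∧ p q []       = refl
  allL-∧ p q (x ∷ xs) rewrite allL-∧ p q xs =
    solve 4 (λ a b c d → (a :* b) :* (c :* d) := (a :* c) :* (b :* d)) refl
      (p x) (q x) (allL p xs) (allL q xs)
    where open ∨-∧-Solver

  anyL⁺ : ∀ {p : A → Bool} {xs x} → x ∈ xs → p x ≡ true → anyL p xs ≡ true
  anyL⁺ {p} (here refl) h rewrite h = refl
  anyL⁺ {p} {y ∷ _} (there x∈) h with p y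
  ... | true  = refl
  ... | false = anyL⁺ x∈ h

  anyL⁻ : ∀ {p : A → Bool} xs → anyL p xs ≡ true → ∃[ x ] p x ≡ true
  anyL⁻ {p} (x ∷ xs) h with p x in px
  ... | true  = x , px
  ... | false = anyL⁻ xs h

module _ {A : Set} where

  count-cong : ∀ {p q : A → Bool} → p ≗ q → ∀ xs → count p xs ≡ count q xs
  count-cong p≗q []       = refl
  count-cong p≗q (x ∷ xs) rewrite p≗q x | count-cong p≗q xs = refl

  count-∷ : ∀ (p : A → Bool) x xs → count p (x ∷ xs) ≡ (if p x then 1 else 0) ℕ.+ count p xs
  count-∷ p x xs with p x
  ... | true  = refl
  ... | false = refl

  count-++ : ∀ (p : A → Bool) xs ys → count p (xs ++ ys) ≡ count p xs ℕ.+ count p ys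
  count-++ p []       ys = refl
  count-++ p (x ∷ xs) ys with p x
  ... | true  = cong suc (count-++ p xs ys)
  ... | false = count-++ p xs ys

  count-none : ∀ {p : A → Bool} xs → (∀ x → p x ≡ false) → count p xs ≡ 0
  count-none []       _ = refl
  count-none (x ∷ xs) h rewrite h x = count-none xs h

  count-Any : ∀ {p : A → Bool} {xs} → Any (λ x → p x ≡ true) xs → ∃[ m ] count p xs ≡ suc m
  count-Any {p} {x ∷ xs} (here px) rewrite px = count p xs , refl
  count-Any {p} {x ∷ xs} (there h) with p x
  ... | true  = count p xs , refl
  ... | false = count-Any h

  count-if : ∀ b (q : A → Bool) xs → count (λ x → b ∧ q x) xs ≡ (if b then count q xs else 0)
  count-if true  q xs = refl
  count-if false q xs = count-none xs (λ _ → refl)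

  count-split : ∀ (b p : A → Bool) xs →
    count p xs ≡ count (λ x → b x ∧ p x) xs ℕ.+ count (λ x → not (b x) ∧ p x) xs
  count-split b p []       = refl
  count-split b p (x ∷ xs) with b x | p x
  ... | true  | true  = cong suc (count-split b p xs)
  ... | false | true  = trans (cong suc (count-split b p xs)) (sym (ℕₚ.+-suc _ _))
  ... | true  | false = count-split b p xs
  ... | false | false = count-split b p xs

  count-∨ : ∀ (p q : A → Bool) xs → (∀ x → p x ∧ q x ≡ false) →
    count (λ x → p x ∨ q x) xs ≡ count p xs ℕ.+ count q xs
  count-∨ p q []       _ = refl
  count-∨ p q (x ∷ xs) disjoint with p x in px | q x in qx
  ... | true  | true  = ⊥-elim (Boolₚ.not-¬ (trans (sym (cong₂ _∧_ px qx)) (disjoint x)) refl)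
  ... | true  | false = cong suc (count-∨ p q xs disjoint)
  ... | false | true  = trans (cong suc (count-∨ p q xs disjoint)) (sym (ℕₚ.+-suc _ _))
  ... | false | false = count-∨ p q xs disjoint

count-map : ∀ {A B : Set} (p : B → Bool) (f : A → B) xs → count p (map f xs) ≡ count (p ∘ f) xs
count-map p f []       = refl
count-map p f (x ∷ xs) with p (f x)
... | true  = cong suc (count-map p f xs)
... | false = count-map p f xs

count-concatMap : ∀ {A B : Set} (p : B → Bool) (f : A → List B) xs →
  count p (concatMap f xs) ≡ sum (map (count p ∘ f) xs)
count-concatMap p f []       = refl
count-concatMap p f (x ∷ xs) =
  trans (count-++ p (f x) (concatMap f xs)) (cong (count p (f x) ℕ.+_) (count-concatMap p f xs))

count-as-sum : ∀ {A : Set} (p : A → Bool) xs → count p xs ≡ sum (map (λ x → if p x then 1 else 0) xs)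
count-as-sum p []       = refl
count-as-sum p (x ∷ xs) with p x
... | true  = cong suc (count-as-sum p xs)
... | false = count-as-sum p xs

sum-map-+ : ∀ {A : Set} (f g : A → ℕ) xs →
  sum (map (λ x → f x ℕ.+ g x) xs) ≡ sum (map f xs) ℕ.+ sum (map g xs)
sum-map-+ f g []       = refl
sum-map-+ f g (x ∷ xs) rewrite sum-map-+ f g xs = ℕ+.interchange (f x) (g x) (sum (map f xs)) (sum (map g xs))

sum-map-cong : ∀ {A : Set} {f g : A → ℕ} → f ≗ g → ∀ xs → sum (map f xs) ≡ sum (map g xs)
sum-map-cong f≗g xs = cong sum (Listₚ.map-cong f≗g xs)

module _ {A : Set} (_≟_ : DecidableEquality A) where

  mult : List A → A → ℕ
  mult xs a = count (λ x → does (x ≟ a)) xs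

  Enumerates : List A → Set
  Enumerates xs = ∀ a → mult xs a ≡ 1

  mult≡suc⇒∈ : ∀ xs a {m} → mult xs a ≡ suc m → a ∈ xs
  mult≡suc⇒∈ (x ∷ xs) a h with x ≟ a
  ... | yes refl = here refl
  ... | no _     = there (mult≡suc⇒∈ xs a h)

  enumerates⇒∈ : ∀ {xs} → Enumerates xs → ∀ a → a ∈ xs
  enumerates⇒∈ enum a = mult≡suc⇒∈ _ a (enum a)

  mult≤1⇒unique : ∀ xs → (∀ a → mult xs a ≤ 1) → Unique xs
  mult≤1⇒unique []       _ = []
  mult≤1⇒unique (x ∷ xs) h =
    All.tabulate x≢ ∷ mult≤1⇒unique xs (λ a → ℕₚ.≤-trans (tail≤ a) (h a))
    where
    x∉xs : mult xs x ≡ 0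
    x∉xs with h x
    ... | h₁ rewrite dec-true (x ≟ x) refl = ℕₚ.n≤0⇒n≡0 (ℕₚ.≤-pred h₁)
    x≢ : ∀ {y} → y ∈ xs → x ≢ y
    x≢ y∈xs refl with count-Any (Any.map (λ y≡x → dec-true (_ ≟ x) y≡x) (Any.map sym y∈xs))
    ... | m , eq = ℕₚ.0≢1+n (trans (sym x∉xs) eq)
    tail≤ : ∀ a → mult xs a ≤ mult (x ∷ xs) a
    tail≤ a with does (x ≟ a)
    ... | true  = ℕₚ.n≤1+n _
    ... | false = ℕₚ.≤-refl

  enumerates⇒unique : ∀ {xs} → Enumerates xs → Unique xs
  enumerates⇒unique enum = mult≤1⇒unique _ (ℕₚ.≤-reflexive ∘ enum)

  count-at : ∀ zs → Enumerates zs → ∀ (P : A → Bool) x →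
    count (λ z → P z ∧ does (x ≟ z)) zs ≡ (if P x then 1 else 0)
  count-at zs enum P x = begin
    count (λ z → P z ∧ does (x ≟ z)) zs  ≡⟨ count-cong at-x zs ⟩
    count (λ z → P x ∧ does (z ≟ x)) zs  ≡⟨ count-if (P x) _ zs ⟩
    (if P x then mult zs x else 0)       ≡⟨ cong (if P x then_else 0) (enum x) ⟩
    (if P x then 1 else 0)               ∎
    where
    open ≡-Reasoning
    at-x : ∀ z → P z ∧ does (x ≟ z) ≡ P x ∧ does (z ≟ x)
    at-x z with z ≟ x | x ≟ z
    ... | yes refl | yes _    = refl
    ... | yes refl | no x≢x   = ⊥-elim (x≢x refl)
    ... | no z≢x   | yes refl = ⊥-elim (z≢x refl)
    ... | no _     | no _     = trans (Boolₚ.∧-zeroʳ (P z)) (sym (Boolₚ.∧-zeroʳ (P x)))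

  count-by-mult : ∀ zs → Enumerates zs → ∀ (P : A → Bool) xs →
    count P xs ≡ sum (map (λ z → if P z then mult xs z else 0) zs)
  count-by-mult zs enum P [] = sym (trans (sum-map-cong if-0 zs) (sum-zeros zs))
    where
    if-0 : ∀ z → (if P z then 0 else 0) ≡ 0
    if-0 z with P z
    ... | true  = refl
    ... | false = refl
    sum-zeros : ∀ ys → sum (map (λ _ → 0) ys) ≡ 0
    sum-zeros []       = refl
    sum-zeros (_ ∷ ys) = sum-zeros ys
  count-by-mult zs enum P (x ∷ xs) = begin
    count P (x ∷ xs)
      ≡⟨ count-∷ P x xs ⟩
    (if P x then 1 else 0) ℕ.+ count P xs
      ≡⟨ cong₂ ℕ._+_ (trans (sym (count-at zs enum P x)) (count-as-sum _ zs)) (count-by-mult zs enum P xs) ⟩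
    sum (map (λ z → if P z ∧ does (x ≟ z) then 1 else 0) zs)
      ℕ.+ sum (map (λ z → if P z then mult xs z else 0) zs)
      ≡⟨ sym (sum-map-+ _ _ zs) ⟩
    sum (map (λ z → (if P z ∧ does (x ≟ z) then 1 else 0) ℕ.+ (if P z then mult xs z else 0)) zs)
      ≡⟨ sum-map-cong mult-∷ zs ⟩
    sum (map (λ z → if P z then mult (x ∷ xs) z else 0) zs)
      ∎
    where
    open ≡-Reasoning
    mult-∷ : ∀ z → (if P z ∧ does (x ≟ z) then 1 else 0) ℕ.+ (if P z then mult xs z else 0)
                 ≡ (if P z then mult (x ∷ xs) z else 0)
    mult-∷ z with P z | does (x ≟ z)
    ... | true  | true  = refl
    ... | true  | false = refl
    ... | false | _     = refl

module _ {A B : Set} (_≟ᴬ_ : DecidableEquality A) (_≟ᴮ_ : DecidableEquality B)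
         (xs : List A) (ys : List B) (xs-enum : Enumerates _≟ᴬ_ xs) (ys-enum : Enumerates _≟ᴮ_ ys)
         (Φ : A → B) (Φ-injective : ∀ {a a′} → Φ a ≡ Φ a′ → a ≡ a′)
         (Q : B → Bool) (Q⇒image : ∀ b → Q b ≡ true → ∃[ a ] Φ a ≡ b)
         (image⇒Q : ∀ a → Q (Φ a) ≡ true)
         where

  private
    mult-image : ∀ b → mult _≟ᴮ_ (map Φ xs) b ≡ (if Q b then 1 else 0)
    mult-image b with Q b in Qb
    ... | true  with Q⇒image b Qb
    ...   | a , refl = trans (count-map _ Φ xs) (trans (count-cong Φ-reflects xs) (xs-enum a))
      where
      Φ-reflects : ∀ x → does (Φ x ≟ᴮ Φ a) ≡ does (x ≟ᴬ a)
      Φ-reflects x = does-⇔ (mk⇔ Φ-injective (cong Φ)) (Φ x ≟ᴮ Φ a) (x ≟ᴬ a)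
    mult-image b | false = trans (count-map _ Φ xs) (count-none xs misses-b)
      where
      misses-b : ∀ x → does (Φ x ≟ᴮ b) ≡ false
      misses-b x = dec-false (Φ x ≟ᴮ b) λ { refl → Boolₚ.not-¬ (image⇒Q x) Qb }

  count-∘-injection : ∀ (P : B → Bool) → count (P ∘ Φ) xs ≡ count (λ b → Q b ∧ P b) ys
  count-∘-injection P = begin
    count (P ∘ Φ) xs
      ≡⟨ sym (count-map P Φ xs) ⟩
    count P (map Φ xs)
      ≡⟨ count-by-mult _≟ᴮ_ ys ys-enum P (map Φ xs) ⟩
    sum (map (λ b → if P b then mult _≟ᴮ_ (map Φ xs) b else 0) ys)
      ≡⟨ sum-map-cong same-terms ys ⟩
    sum (map (λ b → if Q b ∧ P b then mult _≟ᴮ_ ys b else 0) ys)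
      ≡⟨ sym (count-by-mult _≟ᴮ_ ys ys-enum _ ys) ⟩
    count (λ b → Q b ∧ P b) ys
      ∎
    where
    open ≡-Reasoning
    same-terms : ∀ b → (if P b then mult _≟ᴮ_ (map Φ xs) b else 0)
                     ≡ (if Q b ∧ P b then mult _≟ᴮ_ ys b else 0)
    same-terms b rewrite mult-image b | ys-enum b with Q b | P b
    ... | true  | true  = refl
    ... | true  | false = refl
    ... | false | true  = refl
    ... | false | false = refl

count-tabulate-suc : ∀ {n} (p : Fin (suc n) → Bool) →
  count p (List.tabulate {n = n} Fin.suc) ≡ count (p ∘ Fin.suc) (allFin n)
count-tabulate-suc {n} p =
  trans (cong (count p) (sym (Listₚ.map-tabulate id Fin.suc))) (count-map p Fin.suc (allFin n))

enumerates-allFin : ∀ n → Enumerates Fin._≟_ (allFin n)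
enumerates-allFin (suc n) zero    =
  cong suc (trans (count-tabulate-suc {n} _) (count-none (allFin n) (λ _ → refl)))
enumerates-allFin (suc n) (suc a) = trans (count-tabulate-suc {n} _) (enumerates-allFin n a)

enumerates-allVecs : ∀ {A : Set} (_≟_ : DecidableEquality A) xs → Enumerates _≟_ xs →
  ∀ k → Enumerates (Vecₚ.≡-dec _≟_) (allVecs xs k)
enumerates-allVecs _≟_ xs enum zero    []      = refl
enumerates-allVecs {A} _≟_ xs enum (suc k) (y ∷ v) = begin
  count (λ w → does (w ≟ᵛ (y ∷ v))) (concatMap (λ x → map (x ∷_) (allVecs xs k)) xs)
    ≡⟨ count-concatMap _ _ xs ⟩
  sum (map (λ x → count (λ w → does (w ≟ᵛ (y ∷ v))) (map (x ∷_) (allVecs xs k))) xs)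
    ≡⟨ sum-map-cong block xs ⟩
  sum (map (λ x → if does (x ≟ y) then 1 else 0) xs)
    ≡⟨ sym (count-as-sum _ xs) ⟩
  mult _≟_ xs y
    ≡⟨ enum y ⟩
  1 ∎
  where
  open ≡-Reasoning
  _≟ᵛ_ : ∀ {m} → DecidableEquality (Vec A m)
  _≟ᵛ_ = Vecₚ.≡-dec _≟_
  block : ∀ x → count (λ w → does (w ≟ᵛ (y ∷ v))) (map (x ∷_) (allVecs xs k))
              ≡ (if does (x ≟ y) then 1 else 0)
  block x = begin
    count (λ w → does (w ≟ᵛ (y ∷ v))) (map (x ∷_) (allVecs xs k))
      -- ≡-dec decides x ∷ w ≟ y ∷ v by deciding the heads and the tails.
      ≡⟨ count-map _ (x ∷_) (allVecs xs k) ⟩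
    count (λ w → does (x ≟ y) ∧ does (w ≟ᵛ v)) (allVecs xs k)
      ≡⟨ count-if (does (x ≟ y)) _ (allVecs xs k) ⟩
    (if does (x ≟ y) then mult _≟ᵛ_ (allVecs xs k) v else 0)
      ≡⟨ cong (if does (x ≟ y) then_else 0) (enumerates-allVecs _≟_ xs enum k v) ⟩
    (if does (x ≟ y) then 1 else 0)
      ∎

_≟ˢ_ : ∀ {n} → DecidableEquality (Subset n)
_≟ˢ_ = Vecₚ.≡-dec Boolₚ._≟_

enumerates-allSubsets : ∀ n → Enumerates _≟ˢ_ (allSubsets n)
enumerates-allSubsets = enumerates-allVecs Boolₚ._≟_ (true ∷ false ∷ []) enumerates-Bool
  where
  enumerates-Bool : Enumerates Boolₚ._≟_ (true ∷ false ∷ [])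
  enumerates-Bool true  = refl
  enumerates-Bool false = refl

∈-allSubsets : ∀ {n} (S : Subset n) → S ∈ allSubsets n
∈-allSubsets {n} = enumerates⇒∈ _≟ˢ_ (enumerates-allSubsets n)

allSubsetsB⁺ : ∀ {n} {p : Subset n → Bool} → (∀ S → p S ≡ true) → allSubsetsB p ≡ true
allSubsetsB⁺ {n} h = allL⁺ (allSubsets n) (λ {S} _ → h S)

allSubsetsB⁻ : ∀ {n} {p : Subset n → Bool} → allSubsetsB p ≡ true → ∀ S → p S ≡ true
allSubsetsB⁻ h S = allL⁻ h (∈-allSubsets S)

anySubsetsB⁺ : ∀ {n} {p : Subset n → Bool} (S : Subset n) → p S ≡ true → anySubsetsB p ≡ true
anySubsetsB⁺ S = anyL⁺ (∈-allSubsets S)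

anySubsetsB⁻ : ∀ {n} {p : Subset n → Bool} → anySubsetsB p ≡ true → ∃[ S ] p S ≡ true
anySubsetsB⁻ {n} = anyL⁻ (allSubsets n)

ℕ→ℚ≡mkℚ : ∀ n → ℕ→ℚ n ≡ mkℚ (ℤ.+ n) 0 (Coprimality.sym (Coprimality.1-coprimeTo n))
ℕ→ℚ≡mkℚ n = ℚₚ.normalize-coprime (Coprimality.sym (Coprimality.1-coprimeTo n))

ℕ→ℚ-+ : ∀ m n → ℕ→ℚ (m ℕ.+ n) ≡ ℕ→ℚ m + ℕ→ℚ n
ℕ→ℚ-+ m n rewrite ℕ→ℚ≡mkℚ m | ℕ→ℚ≡mkℚ n =
  sym (ℚₚ./-cong {p₂ = ℤ.+ (m ℕ.+ n)} {q₂ = 1} numerator refl)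
  where
  numerator : ℤ.+ m ℤ.* ℤ.+ 1 ℤ.+ ℤ.+ n ℤ.* ℤ.+ 1 ≡ ℤ.+ (m ℕ.+ n)
  numerator = cong₂ ℤ._+_ (ℤₚ.*-identityʳ (ℤ.+ m)) (ℤₚ.*-identityʳ (ℤ.+ n))

ℕ→ℚ-suc≢0 : ∀ n → ℕ→ℚ (suc n) ≢ 0ℚ
ℕ→ℚ-suc≢0 n eq with trans (sym (ℕ→ℚ≡mkℚ (suc n))) eq
... | ()

sumOver : ∀ {A : Set} → List A → (A → ℚ) → ℚ
sumOver []       f = 0ℚ
sumOver (x ∷ xs) f = f x + sumOver xs f

infix 5 sumOver
syntax sumOver xs (λ x → e) = ∑[ x ∈ xs ] e

module _ {A : Set} where

  ∑-cong : ∀ {f g : A → ℚ} → f ≗ g → ∀ xs → ∑[ x ∈ xs ] f x ≡ ∑[ x ∈ xs ] g x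
  ∑-cong f≗g []       = refl
  ∑-cong f≗g (x ∷ xs) = cong₂ _+_ (f≗g x) (∑-cong f≗g xs)

  ∑-++ : ∀ (f : A → ℚ) xs ys → ∑[ x ∈ xs ++ ys ] f x ≡ (∑[ x ∈ xs ] f x) + (∑[ y ∈ ys ] f y)
  ∑-++ f []       ys = sym (ℚₚ.+-identityˡ _)
  ∑-++ f (x ∷ xs) ys = trans (cong (f x +_) (∑-++ f xs ys)) (sym (ℚₚ.+-assoc (f x) _ _))

  ∑-neg : ∀ (f : A → ℚ) xs → ∑[ x ∈ xs ] - f x ≡ - (∑[ x ∈ xs ] f x)
  ∑-neg f []       = refl
  ∑-neg f (x ∷ xs) = trans (cong (- f x +_) (∑-neg f xs)) (sym (ℚₚ.neg-distrib-+ (f x) _))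

  *-distribˡ-∑ : ∀ c (f : A → ℚ) xs → c * (∑[ x ∈ xs ] f x) ≡ ∑[ x ∈ xs ] c * f x
  *-distribˡ-∑ c f []       = ℚₚ.*-zeroʳ c
  *-distribˡ-∑ c f (x ∷ xs) =
    trans (ℚₚ.*-distribˡ-+ c (f x) _) (cong (c * f x +_) (*-distribˡ-∑ c f xs))

∑-map : ∀ {A B : Set} (g : A → B) (f : B → ℚ) xs → ∑[ y ∈ map g xs ] f y ≡ ∑[ x ∈ xs ] f (g x)
∑-map g f []       = refl
∑-map g f (x ∷ xs) = cong (f (g x) +_) (∑-map g f xs)

∑-concatMap : ∀ {A B : Set} (g : A → List B) (f : B → ℚ) xs →
  ∑[ y ∈ concatMap g xs ] f y ≡ ∑[ x ∈ xs ] (∑[ y ∈ g x ] f y)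
∑-concatMap g f []       = refl
∑-concatMap g f (x ∷ xs) =
  trans (∑-++ f (g x) (concatMap g xs)) (cong ((∑[ y ∈ g x ] f y) +_) (∑-concatMap g f xs))

∑-if-constant : ∀ {A : Set} (p : A → Bool) (c : A → ℚ) s xs →
  All (λ x → p x ≡ true → c x ≡ s) xs →
  ∑[ x ∈ xs ] (if p x then c x else 0ℚ) ≡ s * ℕ→ℚ (count p xs)
∑-if-constant p c s []       []         = sym (ℚₚ.*-zeroʳ s)
∑-if-constant p c s (x ∷ xs) (cx ∷ cxs) with p x
... | false = trans (ℚₚ.+-identityˡ _) (∑-if-constant p c s xs cxs)
... | true  = begin
  c x + (∑[ y ∈ xs ] (if p y then c y else 0ℚ))  ≡⟨ cong₂ _+_ (cx refl) (∑-if-constant p c s xs cxs) ⟩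
  s + s * m                                       ≡⟨ cong (_+ s * m) (sym (ℚₚ.*-identityʳ s)) ⟩
  s * 1ℚ + s * m                                  ≡⟨ sym (ℚₚ.*-distribˡ-+ s 1ℚ m) ⟩
  s * (1ℚ + m)                                    ≡⟨ cong (s *_) (sym (ℕ→ℚ-+ 1 (count p xs))) ⟩
  s * ℕ→ℚ (suc (count p xs))                      ∎
  where
  open ≡-Reasoning
  m = ℕ→ℚ (count p xs)

sumℚ≡sum : ∀ {r} (f : Fin r → ℚ) → sumℚ f ≡ FinSum.sum f
sumℚ≡sum {zero}  f = refl
sumℚ≡sum {suc r} f = cong (f zero +_) (sumℚ≡sum (f ∘ suc))

sumℚ-cong : ∀ {r} {f g : Fin r → ℚ} → f ≗ g → sumℚ f ≡ sumℚ g
sumℚ-cong {zero}  f≗g = refl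
sumℚ-cong {suc r} f≗g = cong₂ _+_ (f≗g zero) (sumℚ-cong (f≗g ∘ suc))

sumℚ-+ : ∀ {r} (f g : Fin r → ℚ) → sumℚ (λ i → f i + g i) ≡ sumℚ f + sumℚ g
sumℚ-+ f g = trans (sumℚ≡sum (λ i → f i + g i))
                   (trans (FinSum.∑-distrib-+ f g) (sym (cong₂ _+_ (sumℚ≡sum f) (sumℚ≡sum g))))

sumℚ-zero : ∀ {r} (f : Fin r → ℚ) → (∀ i → f i ≡ 0ℚ) → sumℚ f ≡ 0ℚ
sumℚ-zero {zero}  f f≡0 = refl
sumℚ-zero {suc r} f f≡0 =
  trans (cong₂ _+_ (f≡0 zero) (sumℚ-zero (f ∘ suc) (f≡0 ∘ suc))) (ℚₚ.+-identityˡ 0ℚ)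

sumℚ-δ : ∀ {r} (j : Fin r) (a : ℚ) (h : Fin r → ℚ) →
  sumℚ (λ i → (if j ==ᶠ i then a else 0ℚ) * h i) ≡ a * h j
sumℚ-δ zero    a h =
  trans (cong (a * h zero +_) (sumℚ-zero _ (λ i → ℚₚ.*-zeroˡ (h (suc i))))) (ℚₚ.+-identityʳ _)
sumℚ-δ (suc j) a h =
  trans (cong (_+ tail) (ℚₚ.*-zeroˡ (h zero))) (trans (ℚₚ.+-identityˡ tail) (sumℚ-δ j a (h ∘ suc)))
  where
  tail = sumℚ (λ i → (if j ==ᶠ i then a else 0ℚ) * h (suc i))

∑-collect : ∀ {A : Set} {r} (idx : A → Fin r) (c : A → ℚ) (h : Fin r → ℚ) xs →
  ∑[ x ∈ xs ] c x * h (idx x) ≡ sumℚ (λ i → (∑[ x ∈ xs ] (if idx x ==ᶠ i then c x else 0ℚ)) * h i)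
∑-collect idx c h []       = sym (sumℚ-zero _ (ℚₚ.*-zeroˡ ∘ h))
∑-collect idx c h (x ∷ xs) = begin
  c x * h (idx x) + (∑[ y ∈ xs ] c y * h (idx y))
    ≡⟨ cong₂ _+_ (sym (sumℚ-δ (idx x) (c x) h)) (∑-collect idx c h xs) ⟩
  sumℚ (λ i → (if idx x ==ᶠ i then c x else 0ℚ) * h i) + sumℚ (λ i → rest i * h i)
    ≡⟨ sym (sumℚ-+ (λ i → head i * h i) (λ i → rest i * h i)) ⟩
  sumℚ (λ i → head i * h i + rest i * h i)
    ≡⟨ sumℚ-cong (λ i → sym (ℚₚ.*-distribʳ-+ (h i) (head i) (rest i))) ⟩
  sumℚ (λ i → ((if idx x ==ᶠ i then c x else 0ℚ) + rest i) * h i)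
    ∎
  where
  open ≡-Reasoning
  head rest : _ → ℚ
  head i = if idx x ==ᶠ i then c x else 0ℚ
  rest i = ∑[ y ∈ xs ] (if idx y ==ᶠ i then c y else 0ℚ)

alternating : ℕ → ℚ
alternating zero    = 1ℚ
alternating (suc n) = - alternating n

alternating-square : ∀ n → alternating n * alternating n ≡ 1ℚ
alternating-square zero    = refl
alternating-square (suc n) = begin
  - a * - a       ≡⟨ sym (ℚₚ.neg-distribˡ-* a (- a)) ⟩
  - (a * - a)     ≡⟨ cong -_ (sym (ℚₚ.neg-distribʳ-* a a)) ⟩
  - (- (a * a))   ≡⟨ ℚ+Group.⁻¹-involutive (a * a) ⟩
  a * a           ≡⟨ alternating-square n ⟩
  1ℚ              ∎
  where
  open ≡-Reasoning
  a = alternating n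

x≡y+z⇒z≡x-y : ∀ {x y z : ℚ} → x ≡ y + z → z ≡ x + - y
x≡y+z⇒z≡x-y {x} {y} {z} x≡y+z =
  trans (solve 2 (λ y z → z := (y :+ z) :+ :- y) refl y z) (cong (_+ - y) (sym x≡y+z))
  where open ℚSolver.+-*-Solver

ℕ→ℚ-difference : ∀ x y z → x ≡ y ℕ.+ z → ℕ→ℚ z ≡ ℕ→ℚ x + - ℕ→ℚ y
ℕ→ℚ-difference x y z x≡y+z = x≡y+z⇒z≡x-y (trans (cong ℕ→ℚ x≡y+z) (ℕ→ℚ-+ y z))

if-then-1-else-0 : ∀ b x → (if b then 1ℚ else 0ℚ) * x ≡ (if b then x else 0ℚ)
if-then-1-else-0 true  x = ℚₚ.*-identityˡ x
if-then-1-else-0 false x = ℚₚ.*-zeroˡ x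

unit*x≡0⇒x≡0 : ∀ s {x : ℚ} → s * s ≡ 1ℚ → s * x ≡ 0ℚ → x ≡ 0ℚ
unit*x≡0⇒x≡0 s {x} s*s≡1 s*x≡0 = begin
  x             ≡⟨ sym (ℚₚ.*-identityˡ x) ⟩
  1ℚ * x        ≡⟨ cong (_* x) (sym s*s≡1) ⟩
  (s * s) * x   ≡⟨ ℚₚ.*-assoc s s x ⟩
  s * (s * x)   ≡⟨ cong (s *_) s*x≡0 ⟩
  s * 0ℚ        ≡⟨ ℚₚ.*-zeroʳ s ⟩
  0ℚ            ∎
  where open ≡-Reasoning

∑-if-nonzero : ∀ {A : Set} (p : A → Bool) (c : A → ℚ) s xs → s * s ≡ 1ℚ →
  All (λ x → p x ≡ true → c x ≡ s) xs → Any (λ x → p x ≡ true) xs →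
  ∑[ x ∈ xs ] (if p x then c x else 0ℚ) ≢ 0ℚ
∑-if-nonzero p c s xs s*s≡1 constant hit ∑≡0 = ℕ→ℚ-suc≢0 m (unit*x≡0⇒x≡0 s s*s≡1 s*count≡0)
  where
  m = proj₁ (count-Any hit)
  s*count≡0 : s * ℕ→ℚ (suc m) ≡ 0ℚ
  s*count≡0 = trans (cong (λ k → s * ℕ→ℚ k) (sym (proj₂ (count-Any hit))))
                    (trans (sym (∑-if-constant p c s xs constant)) ∑≡0)

alternating-product-square : ∀ a b →
  (alternating a * alternating b) * (alternating a * alternating b) ≡ 1ℚ
alternating-product-square a b = begin
  (x * y) * (x * y)  ≡⟨ solve 2 (λ x y → (x :* y) :* (x :* y) := (x :* x) :* (y :* y)) refl x y ⟩
  (x * x) * (y * y)  ≡⟨ cong₂ _*_ (alternating-square a) (alternating-square b) ⟩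
  1ℚ * 1ℚ            ≡⟨ ℚₚ.*-identityˡ 1ℚ ⟩
  1ℚ                 ∎
  where
  open ≡-Reasoning
  open ℚSolver.+-*-Solver
  x = alternating a
  y = alternating b

vec-ext : ∀ {A : Set} {n} {v w : Vec A n} → lookup v ≗ lookup w → v ≡ w
vec-ext {v = v} {w} v≗w =
  trans (sym (Vecₚ.tabulate∘lookup v)) (trans (Vecₚ.tabulate-cong v≗w) (Vecₚ.tabulate∘lookup w))

subset-ext : ∀ {n} {S T : Subset n} →
  (∀ i → lookup S i ≡ true → lookup T i ≡ true) →
  (∀ i → lookup T i ≡ true → lookup S i ≡ true) → S ≡ T
subset-ext S⊆T T⊆S = vec-ext (λ i → ≡true-ext (S⊆T i) (T⊆S i))

==ˢ⇒≡ : ∀ {n} (S T : Subset n) → (S ==ˢ T) ≡ true → S ≡ T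
==ˢ⇒≡ S T h = vec-ext (λ i → does⇒ (lookup S i Boolₚ.≟ lookup T i) (allFinB⁻ h i))

==ˢ-refl : ∀ {n} (S : Subset n) → (S ==ˢ S) ≡ true
==ˢ-refl S = allFinB⁺ (λ i → dec-true (lookup S i Boolₚ.≟ lookup S i) refl)

==ˢ≡does : ∀ {n} (S T : Subset n) → (S ==ˢ T) ≡ does (S ≟ˢ T)
==ˢ≡does S T = ≡true-ext (dec-true (S ≟ˢ T) ∘ ==ˢ⇒≡ S T)
                         (λ h → subst (λ U → (S ==ˢ U) ≡ true) (does⇒ (S ≟ˢ T) h) (==ˢ-refl S))

lookup-∅ : ∀ {n} (i : Fin n) → lookup ∅ i ≡ false
lookup-∅ i = Vecₚ.lookup-replicate i false

nonemptyB≡false⇒∅ : ∀ {n} {S : Subset n} → nonemptyB S ≡ false → S ≡ ∅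
nonemptyB≡false⇒∅ h = subset-ext (λ i Si → ⊥-elim (Boolₚ.not-¬ (anyFin⁺ i Si) h))
                                 (λ i ∅i → ⊥-elim (Boolₚ.not-¬ ∅i (lookup-∅ i)))

edge⇒nonempty : ∀ F {S} → edge F S ≡ true → nonemptyB S ≡ true
edge⇒nonempty F {S} h with nonemptyB S in ne
... | true  = refl
... | false = ⊥-elim (Boolₚ.not-¬ h (trans (cong (edge F) (nonemptyB≡false⇒∅ ne)) (noEmpty F)))

module _ {m k : ℕ} (φ : Fin m → Fin k) where

  image⁺ : ∀ S {i} → lookup S i ≡ true → lookup (image φ S) (φ i) ≡ true
  image⁺ S {i} h = trans (Vecₚ.lookup∘tabulate _ (φ i)) (anyFin⁺ i (∧-intro h (==ᶠ-refl (φ i))))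

  image⁻ : ∀ S {j} → lookup (image φ S) j ≡ true → ∃[ i ] lookup S i ≡ true × φ i ≡ j
  image⁻ S {j} h with anyFin⁻ (trans (sym (Vecₚ.lookup∘tabulate _ j)) h)
  ... | i , Si∧φi≡j =
    i , Boolₚ.∧-conicalˡ _ _ Si∧φi≡j , ==ᶠ⇒≡ (Boolₚ.∧-conicalʳ (lookup S i) _ Si∧φi≡j)

  image-∅ : image φ ∅ ≡ ∅
  image-∅ = subset-ext (λ j h → let i , ∅i , _ = image⁻ ∅ h in ⊥-elim (Boolₚ.not-¬ ∅i (lookup-∅ i)))
                       (λ j ∅j → ⊥-elim (Boolₚ.not-¬ ∅j (lookup-∅ j)))

  nonemptyB-image : ∀ S → nonemptyB (image φ S) ≡ nonemptyB S
  nonemptyB-image S = ≡true-ext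
    (λ h → let j , Sj = anyFin⁻ {p = lookup (image φ S)} h; i , Si , _ = image⁻ S Sj in anyFin⁺ i Si)
    (λ h → let i , Si = anyFin⁻ h in anyFin⁺ (φ i) (image⁺ S Si))

image-cong : ∀ {m k} {φ ψ : Fin m → Fin k} → φ ≗ ψ → ∀ S → image φ S ≡ image ψ S
image-cong φ≗ψ S =
  Vecₚ.tabulate-cong (λ j → anyFin-cong (λ i → cong (λ x → lookup S i ∧ (x ==ᶠ j)) (φ≗ψ i)))

image-∘ : ∀ {m k l} (φ : Fin m → Fin k) (ψ : Fin k → Fin l) S → image (ψ ∘ φ) S ≡ image ψ (image φ S)
image-∘ φ ψ S = subset-ext
  (λ j h → let i , Si , ψφi≡j = image⁻ (ψ ∘ φ) S h in
    subst (λ x → lookup (image ψ (image φ S)) x ≡ true) ψφi≡j (image⁺ ψ (image φ S) (image⁺ φ S Si)))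
  (λ j h → let y , φSy , ψy≡j = image⁻ ψ (image φ S) h; i , Si , φi≡y = image⁻ φ S φSy in
    subst (λ x → lookup (image (ψ ∘ φ) S) x ≡ true) (trans (cong ψ φi≡y) ψy≡j) (image⁺ (ψ ∘ φ) S Si))

image-id : ∀ {m} (S : Subset m) → image id S ≡ S
image-id S = subset-ext
  (λ j h → let i , Si , i≡j = image⁻ id S h in subst (λ x → lookup S x ≡ true) i≡j Si)
                        (λ j Sj → image⁺ id S Sj)

allSubsetsB-one-point : ∀ {n} (p : Subset n → Bool) S → allSubsetsB (λ T → (T ==ˢ S) ⇒ᵇ p T) ≡ p S
allSubsetsB-one-point {n} p S = ≡true-ext
  (λ h → ⇒ᵇ-elim (allSubsetsB⁻ {p = λ T → (T ==ˢ S) ⇒ᵇ p T} h S) (==ˢ-refl S))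
  (λ pS → allSubsetsB⁺ {n} λ T → ⇒ᵇ-intro λ T==S →
            subst (λ U → p U ≡ true) (sym (==ˢ⇒≡ T S T==S)) pS)

Extensional : ∀ {m N} → ((Fin m → Fin N) → Bool) → Set
Extensional P = ∀ {φ ψ} → φ ≗ ψ → P φ ≡ P ψ

-- Q singles out the maps that factor through f.
count-precompose : ∀ {m k N} (f : Fin m → Fin k) (g : Fin k → Fin m) → (∀ y → f (g y) ≡ y) →
  (Q : (Fin m → Fin N) → Bool) →
  (∀ φ → Q φ ≡ true → ∀ x → φ (g (f x)) ≡ φ x) → (∀ φ ψ → φ ≗ ψ ∘ f → Q φ ≡ true) →
  (P : (Fin m → Fin N) → Bool) → Extensional P →
  count (λ ψ → P (ψ ∘ f)) (allMaps k N) ≡ count (λ φ → Q φ ∧ P φ) (allMaps m N)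
count-precompose {m} {k} {N} f g f∘g Q Q⇒factors factors⇒Q P P-ext = begin
  count (λ ψ → P (ψ ∘ f)) (allMaps k N)
    ≡⟨ count-map _ lookup (vectors k) ⟩
  count (λ w → P (lookup w ∘ f)) (vectors k)
    ≡⟨ count-cong (λ w → P-ext (sym ∘ Vecₚ.lookup∘tabulate _)) (vectors k) ⟩
  count (λ w → P (lookup (Φ w))) (vectors k)
    ≡⟨ count-∘-injection _≟ᵛ_ _≟ᵛ_ (vectors k) (vectors m) (enumerates-vectors k) (enumerates-vectors m)
                         Φ Φ-injective (Q ∘ lookup) Q⇒image image⇒Q (P ∘ lookup) ⟩
  count (λ v → Q (lookup v) ∧ P (lookup v)) (vectors m)
    ≡⟨ sym (count-map _ lookup (vectors m)) ⟩
  count (λ φ → Q φ ∧ P φ) (allMaps m N)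
    ∎
  where
  open ≡-Reasoning
  vectors : ∀ l → List (Vec (Fin N) l)
  vectors = allVecs (allFin N)
  _≟ᵛ_ : ∀ {l} → DecidableEquality (Vec (Fin N) l)
  _≟ᵛ_ = Vecₚ.≡-dec Fin._≟_
  enumerates-vectors : ∀ l → Enumerates _≟ᵛ_ (vectors l)
  enumerates-vectors = enumerates-allVecs Fin._≟_ (allFin N) (enumerates-allFin N)
  Φ : Vec (Fin N) k → Vec (Fin N) m
  Φ w = tabulate (lookup w ∘ f)
  Φ-injective : ∀ {w w′} → Φ w ≡ Φ w′ → w ≡ w′
  Φ-injective {w} {w′} eq = vec-ext λ y → begin
    lookup w y           ≡⟨ cong (lookup w) (sym (f∘g y)) ⟩
    lookup w (f (g y))   ≡⟨ sym (Vecₚ.lookup∘tabulate _ (g y)) ⟩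
    lookup (Φ w) (g y)   ≡⟨ cong (λ v → lookup v (g y)) eq ⟩
    lookup (Φ w′) (g y)  ≡⟨ Vecₚ.lookup∘tabulate _ (g y) ⟩
    lookup w′ (f (g y))  ≡⟨ cong (lookup w′) (f∘g y) ⟩
    lookup w′ y          ∎
  Q⇒image : ∀ v → Q (lookup v) ≡ true → ∃[ w ] Φ w ≡ v
  Q⇒image v Qv = tabulate (lookup v ∘ g) , vec-ext λ x →
    trans (Vecₚ.lookup∘tabulate _ x) (trans (Vecₚ.lookup∘tabulate _ (f x)) (Q⇒factors (lookup v) Qv x))
  image⇒Q : ∀ w → Q (lookup (Φ w)) ≡ true
  image⇒Q w = factors⇒Q (lookup (Φ w)) (lookup w) (Vecₚ.lookup∘tabulate _)

module _ {k : ℕ} {a b : Fin (suc k)} (a≢b : a ≢ b) where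

  merge : Fin (suc k) → Fin k
  merge x with x Fin.≟ b
  ... | yes _   = punchOut {i = b} {j = a} (a≢b ∘ sym)
  ... | no x≢b  = punchOut {i = b} {j = x} (x≢b ∘ sym)

  merge-punchIn : ∀ y → merge (punchIn b y) ≡ y
  merge-punchIn y with punchIn b y Fin.≟ b
  ... | yes b≡ = ⊥-elim (Finₚ.punchInᵢ≢i b y b≡)
  ... | no _   = trans (Finₚ.punchOut-cong b refl) (Finₚ.punchOut-punchIn b)

  merge-identifies : merge a ≡ merge b
  merge-identifies with a Fin.≟ b | b Fin.≟ b
  ... | yes a≡b | _       = ⊥-elim (a≢b a≡b)
  ... | no _    | yes _   = Finₚ.punchOut-cong b refl
  ... | no _    | no b≢b  = ⊥-elim (b≢b refl)

  punchIn-merge : ∀ x → x ≢ b → punchIn b (merge x) ≡ x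
  punchIn-merge x x≢b with x Fin.≟ b
  ... | yes x≡b = ⊥-elim (x≢b x≡b)
  ... | no _    = Finₚ.punchIn-punchOut _

  punchIn-merge-b : punchIn b (merge b) ≡ a
  punchIn-merge-b with b Fin.≟ b
  ... | yes _   = Finₚ.punchIn-punchOut _
  ... | no b≢b  = ⊥-elim (b≢b refl)

  merge-surjective : Surjective _≡_ _≡_ merge
  merge-surjective y = punchIn b y , λ z≡ → trans (cong merge z≡) (merge-punchIn y)

  count-merge : ∀ {N} (P : (Fin (suc k) → Fin N) → Bool) → Extensional P →
    count (λ ψ → P (ψ ∘ merge)) (allMaps k N) ≡ count (λ φ → (φ a ==ᶠ φ b) ∧ P φ) (allMaps (suc k) N)
  count-merge = count-precompose merge (punchIn b) merge-punchIn (λ φ → φ a ==ᶠ φ b) factors identifies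
    where
    factors : ∀ φ → (φ a ==ᶠ φ b) ≡ true → ∀ x → φ (punchIn b (merge x)) ≡ φ x
    factors φ φa≡φb x with x Fin.≟ b
    ... | yes refl = trans (cong φ punchIn-merge-b) (==ᶠ⇒≡ φa≡φb)
    ... | no x≢b   = cong φ (punchIn-merge x x≢b)
    identifies : ∀ φ ψ → φ ≗ ψ ∘ merge → (φ a ==ᶠ φ b) ≡ true
    identifies φ ψ φ≗ψ∘merge = dec-true (φ a Fin.≟ φ b)
      (trans (φ≗ψ∘merge a) (trans (cong ψ merge-identifies) (sym (φ≗ψ∘merge b))))

module _ (F G : Hypergraph) where

  isHom⁺ : ∀ φ → (∀ S → edge F S ≡ true → edge G (image φ S) ≡ true) → isHom F G φ ≡ true
  isHom⁺ φ h = allSubsetsB⁺ (λ S → ⇒ᵇ-intro (h S))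

  isHom⁻ : ∀ φ → isHom F G φ ≡ true → ∀ S → edge F S ≡ true → edge G (image φ S) ≡ true
  isHom⁻ φ h S = ⇒ᵇ-elim (allSubsetsB⁻ {p = λ S → edge F S ⇒ᵇ edge G (image φ S)} h S)

  isHom-cong : Extensional (isHom F G)
  isHom-cong φ≗ψ =
    allL-cong (All.universal (λ S → cong (λ T → edge F S ⇒ᵇ edge G T) (image-cong φ≗ψ S)) (allSubsets (size F)))

module _ (Y : Hypergraph) {k : ℕ} (p : Fin (size Y) → Fin k) where

  quotEdge⁺ : ∀ {S} → edge Y S ≡ true → quotEdge Y p (image p S) ≡ true
  quotEdge⁺ {S} YS = ∧-intro (trans (nonemptyB-image p S) (edge⇒nonempty Y YS))
                             (anySubsetsB⁺ S (∧-intro YS (==ˢ-refl (image p S))))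

  quotEdge⁻ : ∀ T → quotEdge Y p T ≡ true → ∃[ S ] edge Y S ≡ true × image p S ≡ T
  quotEdge⁻ T h =
    let S , YS∧pS≡T = anySubsetsB⁻ (Boolₚ.∧-conicalʳ (nonemptyB T) _ h)
    in S , Boolₚ.∧-conicalˡ _ _ YS∧pS≡T , ==ˢ⇒≡ (image p S) T (Boolₚ.∧-conicalʳ (edge Y S) _ YS∧pS≡T)

  isHom-quotient : ∀ G (ψ : Fin k → Fin (size G)) → isHom (quotient Y p) G ψ ≡ isHom Y G (ψ ∘ p)
  isHom-quotient G ψ = ≡true-ext
    (λ h → isHom⁺ Y G (ψ ∘ p) λ S YS → subst (λ T → edge G T ≡ true) (sym (image-∘ p ψ S))
                                          (isHom⁻ (quotient Y p) G ψ h (image p S) (quotEdge⁺ YS)))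
    (λ h → isHom⁺ (quotient Y p) G ψ λ T YpT → let S , YS , pS≡T = quotEdge⁻ T YpT in
             subst (λ U → edge G (image ψ U) ≡ true) pS≡T
               (subst (λ U → edge G U ≡ true) (image-∘ p ψ S) (isHom⁻ Y G (ψ ∘ p) h S YS)))

≅-by-edges : ∀ {n} {e e′ : Subset n → Bool} {e∅ e′∅} → e ≗ e′ →
  hypergraph n e e∅ ≅ hypergraph n e′ e′∅
≅-by-edges {e′ = e′} e≗e′ =
  id , Identity.bijective _≡_ , λ S → trans (e≗e′ S) (cong e′ (sym (image-id S)))

≅-quotient-id : ∀ F → F ≅ quotient F id
≅-quotient-id F = ≅-by-edges {e∅ = noEmpty F} {e′∅ = quotEdge-⊥ F id} λ T → ≡true-ext
  (λ FT → subst (λ U → quotEdge F id U ≡ true) (image-id T) (quotEdge⁺ F id FT))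
  (λ h → let S , FS , S≡T = quotEdge⁻ F id T h in
           subst (λ U → edge F U ≡ true) (trans (sym (image-id S)) S≡T) FS)

#edges : ∀ {n} → (Subset n → Bool) → ℕ
#edges {n} e = count e (allSubsets n)

module _ {F F′ : Hypergraph} (F≅F′ : F ≅ F′) where

  private
    φ : Fin (size F) → Fin (size F′)
    φ = proj₁ F≅F′
    φ-injective : ∀ {x x′} → φ x ≡ φ x′ → x ≡ x′
    φ-injective = proj₁ (proj₁ (proj₂ F≅F′))
    φ-edge : ∀ S → edge F S ≡ edge F′ (image φ S)
    φ-edge = proj₂ (proj₂ F≅F′)
    φ⁻¹ : Fin (size F′) → Fin (size F)
    φ⁻¹ y = proj₁ (proj₂ (proj₁ (proj₂ F≅F′)) y)
    φ∘φ⁻¹ : ∀ y → φ (φ⁻¹ y) ≡ y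
    φ∘φ⁻¹ y = proj₂ (proj₂ (proj₁ (proj₂ F≅F′)) y) refl
    φ⁻¹∘φ : ∀ x → φ⁻¹ (φ x) ≡ x
    φ⁻¹∘φ x = φ-injective (φ∘φ⁻¹ (φ x))
    φ⁻¹-injective : ∀ {y y′} → φ⁻¹ y ≡ φ⁻¹ y′ → y ≡ y′
    φ⁻¹-injective {y} {y′} eq = trans (sym (φ∘φ⁻¹ y)) (trans (cong φ eq) (φ∘φ⁻¹ y′))
    image-φ∘φ⁻¹ : ∀ T → image φ (image φ⁻¹ T) ≡ T
    image-φ∘φ⁻¹ T = trans (sym (image-∘ φ⁻¹ φ T)) (trans (image-cong φ∘φ⁻¹ T) (image-id T))
    image-φ⁻¹∘φ : ∀ S → image φ⁻¹ (image φ S) ≡ S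
    image-φ⁻¹∘φ S = trans (sym (image-∘ φ φ⁻¹ S)) (trans (image-cong φ⁻¹∘φ S) (image-id S))

  ≅-sym : F′ ≅ F
  ≅-sym = φ⁻¹ , (φ⁻¹-injective , λ x → φ x , λ z≡φx → trans (cong φ⁻¹ z≡φx) (φ⁻¹∘φ x)) ,
          λ T → sym (trans (φ-edge (image φ⁻¹ T)) (cong (edge F′) (image-φ∘φ⁻¹ T)))

  ≅⇒size≡ : size F ≡ size F′
  ≅⇒size≡ = ℕₚ.≤-antisym (Finₚ.injective⇒≤ φ-injective) (Finₚ.injective⇒≤ φ⁻¹-injective)

  isHom-∘-≅ : ∀ G ψ → isHom F G (ψ ∘ φ) ≡ isHom F′ G ψ
  isHom-∘-≅ G ψ = ≡true-ext
    (λ h → isHom⁺ F′ G ψ λ T F′T →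
      subst (λ U → edge G U ≡ true) (trans (image-∘ φ ψ (image φ⁻¹ T)) (cong (image ψ) (image-φ∘φ⁻¹ T)))
        (isHom⁻ F G (ψ ∘ φ) h (image φ⁻¹ T)
          (trans (φ-edge _) (trans (cong (edge F′) (image-φ∘φ⁻¹ T)) F′T))))
    (λ h → isHom⁺ F G (ψ ∘ φ) λ S FS →
      subst (λ U → edge G U ≡ true) (sym (image-∘ φ ψ S))
        (isHom⁻ F′ G ψ h (image φ S) (trans (sym (φ-edge S)) FS)))

  ≅⇒#Hom≡ : ∀ G → #Hom F G ≡ #Hom F′ G
  ≅⇒#Hom≡ G = sym (begin
    count (isHom F′ G) (allMaps (size F′) (size G))
      ≡⟨ count-cong (sym ∘ isHom-∘-≅ G) (allMaps (size F′) (size G)) ⟩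
    count (λ ψ → isHom F G (ψ ∘ φ)) (allMaps (size F′) (size G))
      ≡⟨ count-precompose φ φ⁻¹ φ∘φ⁻¹ (λ _ → true) (λ χ _ x → cong χ (φ⁻¹∘φ x)) (λ _ _ _ → refl)
                          (isHom F G) (isHom-cong F G) ⟩
    count (isHom F G) (allMaps (size F) (size G))
      ∎)
    where open ≡-Reasoning

  ≅⇒#edges≡ : #edges (edge F) ≡ #edges (edge F′)
  ≅⇒#edges≡ = trans (count-cong φ-edge (allSubsets (size F)))
    (count-∘-injection _≟ˢ_ _≟ˢ_ (allSubsets (size F)) (allSubsets (size F′))
      (enumerates-allSubsets (size F)) (enumerates-allSubsets (size F′))
      (image φ) (λ {S} {S′} φS≡φS′ →
                   trans (sym (image-φ⁻¹∘φ S)) (trans (cong (image φ⁻¹) φS≡φS′) (image-φ⁻¹∘φ S′)))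
      (λ _ → true) (λ T _ → image φ⁻¹ T , image-φ∘φ⁻¹ T) (λ _ → refl) (edge F′))

≅-trans : ∀ {F F′ F″} → F ≅ F′ → F′ ≅ F″ → F ≅ F″
≅-trans {F″ = F″} (φ , φ-bijective , φ-edge) (ψ , ψ-bijective , ψ-edge) =
  ψ ∘ φ , Composition.bijective _≡_ _≡_ _≡_ φ-bijective ψ-bijective ,
  λ S → trans (φ-edge S) (trans (ψ-edge (image φ S)) (cong (edge F″) (sym (image-∘ φ ψ S))))

≅-refl : ∀ F → F ≅ F
≅-refl F = ≅-by-edges {e∅ = noEmpty F} {e′∅ = noEmpty F} λ _ → refl

-- Injective maps by deletion–contraction

record WeightedPartition (n k : ℕ) : Set where
  constructor weighted
  field
    weight           : ℚ
    blocks           : ℕ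
    blocks<k         : blocks < k
    label            : Fin n → Fin blocks
    label-surjective : Surjective _≡_ _≡_ label
open WeightedPartition public

negate : ∀ {n k} → WeightedPartition n k → WeightedPartition n k
negate (weighted w b b<k q q-surjective) = weighted (- w) b b<k q q-surjective

weaken : ∀ {n k} → WeightedPartition n k → WeightedPartition n (suc k)
weaken (weighted w b b<k q q-surjective) = weighted w b (ℕₚ.m<n⇒m<1+n b<k) q q-surjective

separates : ∀ {n m} → (Fin n → Fin m) → Fin n × Fin n → Bool
separates φ (c , d) = (φ c ==ᶠ φ d) ⇒ᵇ (c ==ᶠ d)

injectiveOn : ∀ {n m} → (Fin n → Fin m) → List (Fin n × Fin n) → Bool
injectiveOn φ = allL (separates φ)

injectiveOn-cong : ∀ {n m} {φ ψ : Fin n → Fin m} → φ ≗ ψ → ∀ X → injectiveOn φ X ≡ injectiveOn ψ X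
injectiveOn-cong φ≗ψ X =
  allL-cong (All.universal (λ (c , d) → cong₂ (λ x y → (x ==ᶠ y) ⇒ᵇ (c ==ᶠ d)) (φ≗ψ c) (φ≗ψ d)) X)

module _ {n N : ℕ} (R : (Fin n → Fin N) → Bool) where

  -- For R = isHom Y G this is #Hom (quotient Y q) G, see #Hom-quotient.
  #through : ∀ {k} → (Fin n → Fin k) → ℕ
  #through {k} q = count (λ ψ → R (ψ ∘ q)) (allMaps k N)

  weighted-count : ∀ {k} → List (WeightedPartition n k) → ℚ
  weighted-count ts = ∑[ t ∈ ts ] weight t * ℕ→ℚ (#through (label t))

  weighted-count-negate : ∀ {k} (ts : List (WeightedPartition n k)) →
    weighted-count (map negate ts) ≡ - weighted-count ts
  weighted-count-negate ts = begin
    weighted-count (map negate ts)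
      ≡⟨ ∑-map negate _ ts ⟩
    ∑[ t ∈ ts ] - weight t * ℕ→ℚ (#through (label t))
      ≡⟨ ∑-cong (λ t → sym (ℚₚ.neg-distribˡ-* (weight t) _)) ts ⟩
    ∑[ t ∈ ts ] - (weight t * ℕ→ℚ (#through (label t)))
      ≡⟨ ∑-neg _ ts ⟩
    - weighted-count ts
      ∎
    where open ≡-Reasoning

  weighted-count-weaken : ∀ {k} (ts : List (WeightedPartition n k)) →
    weighted-count (map weaken ts) ≡ weighted-count ts
  weighted-count-weaken = ∑-map weaken _

separates-diagonal : ∀ {n m} (φ : Fin n → Fin m) c → separates φ (c , c) ≡ true
separates-diagonal φ c rewrite ==ᶠ-refl c = Boolₚ.∨-zeroʳ _

separates-distinct : ∀ {n m} (φ : Fin n → Fin m) {c d} → c ≢ d → separates φ (c , d) ≡ not (φ c ==ᶠ φ d)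
separates-distinct φ c≢d rewrite ≢⇒==ᶠ-false c≢d = Boolₚ.∨-identityʳ _

#injectiveOn : ∀ {n k N} → ((Fin n → Fin N) → Bool) → (Fin n → Fin k) → List (Fin n × Fin n) → ℕ
#injectiveOn {k = k} {N} R q X = count (λ ψ → injectiveOn (ψ ∘ q) X ∧ R (ψ ∘ q)) (allMaps k N)

deletion-contraction : ∀ {n k N} (q : Fin n → Fin (suc k)) {c d} → c ≢ d → (qc≢qd : q c ≢ q d) →
  ∀ X (R : (Fin n → Fin N) → Bool) → Extensional R →
  #injectiveOn R q X ≡ #injectiveOn R (merge qc≢qd ∘ q) X ℕ.+ #injectiveOn R q ((c , d) ∷ X)
deletion-contraction {k = k} {N} q {c} {d} c≢d qc≢qd X R R-ext = begin
  #injectiveOn R q X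
    ≡⟨ count-split E P maps ⟩
  count (λ ψ → E ψ ∧ P ψ) maps ℕ.+ count (λ ψ → not (E ψ) ∧ P ψ) maps
    ≡⟨ cong₂ ℕ._+_ (sym (count-merge qc≢qd P P-ext)) (count-cong (sym ∘ P-with-cd) maps) ⟩
  #injectiveOn R (merge qc≢qd ∘ q) X ℕ.+ #injectiveOn R q ((c , d) ∷ X)
    ∎
  where
  open ≡-Reasoning
  maps = allMaps (suc k) N
  E P : (Fin (suc k) → Fin N) → Bool
  E ψ = ψ (q c) ==ᶠ ψ (q d)
  P ψ = injectiveOn (ψ ∘ q) X ∧ R (ψ ∘ q)
  P-ext : Extensional P
  P-ext φ≗ψ = cong₂ _∧_ (injectiveOn-cong (φ≗ψ ∘ q) X) (R-ext (φ≗ψ ∘ q))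
  P-with-cd : ∀ ψ → injectiveOn (ψ ∘ q) ((c , d) ∷ X) ∧ R (ψ ∘ q) ≡ not (E ψ) ∧ P ψ
  P-with-cd ψ rewrite separates-distinct (ψ ∘ q) c≢d = Boolₚ.∧-assoc (not (E ψ)) (injectiveOn (ψ ∘ q) X) (R (ψ ∘ q))

-- The head term drops out once q itself merges a pair of X; every other term has fewer than k blocks.
InjectiveOnExpansion : ∀ {n k} → (Fin n → Fin k) → List (Fin n × Fin n) → Set
InjectiveOnExpansion {n} {k} q X = Σ (List (WeightedPartition n k)) λ ts →
  ∀ {N} (R : (Fin n → Fin N) → Bool) → Extensional R →
    ℕ→ℚ (#injectiveOn R q X) ≡ (if injectiveOn q X then ℕ→ℚ (#through R q) else 0ℚ) + weighted-count R ts

expansion-diagonal : ∀ {n k} (q : Fin n → Fin k) c X →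
  InjectiveOnExpansion q X → InjectiveOnExpansion q ((c , c) ∷ X)
expansion-diagonal {k = k} q c X (ts , expansion) = ts , λ {N} R R-ext → begin
  ℕ→ℚ (#injectiveOn R q ((c , c) ∷ X))
    ≡⟨ cong ℕ→ℚ (count-cong (λ ψ → cong (λ b → (b ∧ injectiveOn (ψ ∘ q) X) ∧ R (ψ ∘ q))
                                        (separates-diagonal (ψ ∘ q) c))
                            (allMaps k N)) ⟩
  ℕ→ℚ (#injectiveOn R q X)
    ≡⟨ expansion R R-ext ⟩
  (if injectiveOn q X then ℕ→ℚ (#through R q) else 0ℚ) + weighted-count R ts
    ≡⟨ cong (λ b → (if b ∧ injectiveOn q X then ℕ→ℚ (#through R q) else 0ℚ) + weighted-count R ts)
            (sym (separates-diagonal q c)) ⟩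
  (if injectiveOn q ((c , c) ∷ X) then ℕ→ℚ (#through R q) else 0ℚ) + weighted-count R ts
    ∎
  where open ≡-Reasoning

expansion-collapsed : ∀ {n k} (q : Fin n → Fin k) {c d} → c ≢ d → q c ≡ q d → ∀ X →
  InjectiveOnExpansion q ((c , d) ∷ X)
expansion-collapsed {n} {k} q {c} {d} c≢d qc≡qd X = [] , λ {N} R _ → begin
  ℕ→ℚ (#injectiveOn R q ((c , d) ∷ X))
    ≡⟨ cong ℕ→ℚ (count-none (allMaps k N) λ ψ → cong (λ b → (b ∧ injectiveOn (ψ ∘ q) X) ∧ R (ψ ∘ q))
                                                         (collapses (ψ ∘ q) (cong ψ qc≡qd))) ⟩
  0ℚ
    ≡⟨ cong (λ b → (if b ∧ injectiveOn q X then ℕ→ℚ (#through R q) else 0ℚ) + 0ℚ)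
            (sym (collapses q qc≡qd)) ⟩
  (if injectiveOn q ((c , d) ∷ X) then ℕ→ℚ (#through R q) else 0ℚ) + 0ℚ
    ∎
  where
  open ≡-Reasoning
  collapses : ∀ {m} (φ : Fin n → Fin m) → φ c ≡ φ d → separates φ (c , d) ≡ false
  collapses φ φc≡φd rewrite separates-distinct φ c≢d | dec-true (φ c Fin.≟ φ d) φc≡φd = refl

expansion-contraction : ∀ {n k} (q : Fin n → Fin (suc k)) {c d} (c≢d : c ≢ d) (qc≢qd : q c ≢ q d) X →
  Surjective _≡_ _≡_ (merge qc≢qd ∘ q) →
  InjectiveOnExpansion q X → InjectiveOnExpansion (merge qc≢qd ∘ q) X → InjectiveOnExpansion q ((c , d) ∷ X)
expansion-contraction {n} {k} q {c} {d} c≢d qc≢qd X q′-surjective (ts₁ , expansion₁) (ts₂ , expansion₂) =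
  ts₁ ++ map negate (contracted ∷ map weaken ts₂) , λ {N} R R-ext → begin
    ℕ→ℚ (#injectiveOn R q ((c , d) ∷ X))
      ≡⟨ ℕ→ℚ-difference (#injectiveOn R q X) (#injectiveOn R q′ X) (#injectiveOn R q ((c , d) ∷ X))
                          (deletion-contraction q c≢d qc≢qd X R R-ext) ⟩
    ℕ→ℚ (#injectiveOn R q X) + - ℕ→ℚ (#injectiveOn R q′ X)
      ≡⟨ cong₂ (λ x y → x + - y) (expansion₁ R R-ext) (expansion₂ R R-ext) ⟩
    (head R + weighted-count R ts₁) + - (head′ R + weighted-count R ts₂)
      ≡⟨ ℚₚ.+-assoc (head R) _ _ ⟩
    head R + (weighted-count R ts₁ + - (head′ R + weighted-count R ts₂))
      ≡⟨ cong₂ _+_ (cong (λ b → if b then ℕ→ℚ (#through R q) else 0ℚ) (sym injective-at-cd))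
                   (cong (λ x → weighted-count R ts₁ + - x) (sym (contracted-terms R))) ⟩
    head-at-cd R + (weighted-count R ts₁ + - weighted-count R (contracted ∷ map weaken ts₂))
      ≡⟨ cong (head-at-cd R +_) (sym (trans (∑-++ (λ t → weight t * ℕ→ℚ (#through R (label t))) ts₁ _)
                                            (cong (weighted-count R ts₁ +_)
                                                  (weighted-count-negate R (contracted ∷ map weaken ts₂))))) ⟩
    head-at-cd R + weighted-count R (ts₁ ++ map negate (contracted ∷ map weaken ts₂))
      ∎
  where
  open ≡-Reasoning
  q′ : Fin n → Fin k
  q′ = merge qc≢qd ∘ q
  contracted : WeightedPartition n (suc k)
  contracted = weighted (if injectiveOn q′ X then 1ℚ else 0ℚ) k (ℕₚ.n<1+n k) q′ q′-surjective
  head head′ head-at-cd : ∀ {N} → ((Fin n → Fin N) → Bool) → ℚ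
  head R       = if injectiveOn q X then ℕ→ℚ (#through R q) else 0ℚ
  head′ R      = if injectiveOn q′ X then ℕ→ℚ (#through R q′) else 0ℚ
  head-at-cd R = if injectiveOn q ((c , d) ∷ X) then ℕ→ℚ (#through R q) else 0ℚ
  injective-at-cd : injectiveOn q ((c , d) ∷ X) ≡ injectiveOn q X
  injective-at-cd = cong (_∧ injectiveOn q X) (trans (separates-distinct q c≢d) (cong not (≢⇒==ᶠ-false qc≢qd)))
  contracted-terms : ∀ {N} (R : (Fin n → Fin N) → Bool) →
    weighted-count R (contracted ∷ map weaken ts₂) ≡ head′ R + weighted-count R ts₂
  contracted-terms R = cong₂ _+_ (if-then-1-else-0 (injectiveOn q′ X) _) (weighted-count-weaken R ts₂)

injectiveOn-expansion : ∀ {n k} (q : Fin n → Fin k) → Surjective _≡_ _≡_ q → ∀ X → InjectiveOnExpansion q X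
injectiveOn-expansion q _ [] = [] , λ R _ → sym (ℚₚ.+-identityʳ _)
injectiveOn-expansion {k = zero} q _ ((c , _) ∷ _) = ⊥-elim (Finₚ.¬Fin0 (q c))
injectiveOn-expansion {k = suc k} q q-surjective ((c , d) ∷ X) = by-cases (c Fin.≟ d) (q c Fin.≟ q d)
  where
  by-cases : Dec (c ≡ d) → Dec (q c ≡ q d) → InjectiveOnExpansion q ((c , d) ∷ X)
  by-cases (yes refl) _          = expansion-diagonal q c X (injectiveOn-expansion q q-surjective X)
  by-cases (no c≢d)  (yes qc≡qd) = expansion-collapsed q c≢d qc≡qd X
  by-cases (no c≢d)  (no qc≢qd)  = expansion-contraction q c≢d qc≢qd X q′-surjective
    (injectiveOn-expansion q q-surjective X) (injectiveOn-expansion (merge qc≢qd ∘ q) q′-surjective X)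
    where
    q′-surjective : Surjective _≡_ _≡_ (merge qc≢qd ∘ q)
    q′-surjective = Composition.surjective _≡_ _≡_ _≡_ q-surjective (merge-surjective qc≢qd)

allPairs : ∀ n → List (Fin n × Fin n)
allPairs n = List.cartesianProduct (allFin n) (allFin n)

injectiveB≡injectiveOn-allPairs : ∀ {n m} (φ : Fin n → Fin m) → injectiveB φ ≡ injectiveOn φ (allPairs n)
injectiveB≡injectiveOn-allPairs {n} φ = ≡true-ext
  (λ h → allL⁺ (allPairs n) λ { {c , d} _ → allFinB⁻ (allFinB⁻ h c) d })
  (λ h → allFinB⁺ λ c → allFinB⁺ λ d →
           allL⁻ {p = separates φ} h (∈ₚ.∈-cartesianProduct⁺ (∈ₚ.∈-allFin c) (∈ₚ.∈-allFin d)))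

injective-expansion : ∀ n → Σ (List (WeightedPartition n n)) λ ts →
  ∀ {N} (R : (Fin n → Fin N) → Bool) → Extensional R →
    ℕ→ℚ (count (λ φ → injectiveB φ ∧ R φ) (allMaps n N)) ≡ ℕ→ℚ (count R (allMaps n N)) + weighted-count R ts
injective-expansion n = ts , λ {N} R R-ext → begin
  ℕ→ℚ (count (λ φ → injectiveB φ ∧ R φ) (allMaps n N))
    ≡⟨ cong ℕ→ℚ (count-cong (λ φ → cong (_∧ R φ) (injectiveB≡injectiveOn-allPairs φ)) (allMaps n N)) ⟩
  ℕ→ℚ (#injectiveOn R id (allPairs n))
    ≡⟨ expansion R R-ext ⟩
  (if injectiveOn id (allPairs n) then ℕ→ℚ (count R (allMaps n N)) else 0ℚ) + weighted-count R ts
    ≡⟨ cong (λ b → (if b then ℕ→ℚ (count R (allMaps n N)) else 0ℚ) + weighted-count R ts) id-injective ⟩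
  ℕ→ℚ (count R (allMaps n N)) + weighted-count R ts
    ∎
  where
  open ≡-Reasoning
  ts = proj₁ (injectiveOn-expansion id (Identity.surjective _≡_) (allPairs n))
  expansion = proj₂ (injectiveOn-expansion id (Identity.surjective _≡_) (allPairs n))
  id-injective : injectiveOn id (allPairs n) ≡ true
  id-injective = trans (sym (injectiveB≡injectiveOn-allPairs {n} id))
                       (allFinB⁺ {n} λ c → allFinB⁺ {n} λ d → ⇒ᵇ-intro {c ==ᶠ d} id)

-- Inclusion–exclusion over new edges

_∪｛_｝ : ∀ {n} → (Subset n → Bool) → Subset n → Subset n → Bool
(e ∪｛ S ｝) T = e T ∨ (T ==ˢ S)

#edges-∪ : ∀ {n} (e : Subset n → Bool) S → e S ≡ false → #edges (e ∪｛ S ｝) ≡ suc (#edges e)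
#edges-∪ {n} e S eS = begin
  count (λ T → e T ∨ (T ==ˢ S)) (allSubsets n)
    ≡⟨ count-∨ e (_==ˢ S) (allSubsets n) disjoint ⟩
  #edges e ℕ.+ count (_==ˢ S) (allSubsets n)
    ≡⟨ cong (#edges e ℕ.+_) (trans (count-cong (λ T → ==ˢ≡does T S) (allSubsets n)) (enumerates-allSubsets n S)) ⟩
  #edges e ℕ.+ 1
    ≡⟨ ℕₚ.+-comm (#edges e) 1 ⟩
  suc (#edges e)
    ∎
  where
  open ≡-Reasoning
  disjoint : ∀ T → e T ∧ (T ==ˢ S) ≡ false
  disjoint T with T ==ˢ S in T==S
  ... | true  = trans (Boolₚ.∧-identityʳ (e T)) (trans (cong e (==ˢ⇒≡ T S T==S)) eS)
  ... | false = Boolₚ.∧-zeroʳ (e T)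

isHom-∪ : ∀ {n} (e : Subset n → Bool) S e∅ e∅′ G φ →
  isHom (hypergraph n (e ∪｛ S ｝) e∅′) G φ ≡ isHom (hypergraph n e e∅) G φ ∧ edge G (image φ S)
isHom-∪ {n} e S _ _ G φ = begin
  allSubsetsB (λ T → (e T ∨ (T ==ˢ S)) ⇒ᵇ g T)
    ≡⟨ allL-cong (All.universal (λ T → ∨-⇒ᵇ (e T) (T ==ˢ S) (g T)) (allSubsets n)) ⟩
  allSubsetsB (λ T → (e T ⇒ᵇ g T) ∧ ((T ==ˢ S) ⇒ᵇ g T))
    ≡⟨ allL-∧ _ _ (allSubsets n) ⟩
  allSubsetsB (λ T → e T ⇒ᵇ g T) ∧ allSubsetsB (λ T → (T ==ˢ S) ⇒ᵇ g T)
    ≡⟨ cong (allSubsetsB (λ T → e T ⇒ᵇ g T) ∧_) (allSubsetsB-one-point g S) ⟩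
  allSubsetsB (λ T → e T ⇒ᵇ g T) ∧ g S
    ∎
  where
  open ≡-Reasoning
  g : Subset n → Bool
  g T = edge G (image φ T)

module _ (H : Hypergraph) where

  private
    n = size H

  record SignedSuperEdges : Set where
    constructor signed
    field
      sign  : ℚ
      edges : Subset n → Bool
      super : IsSuperEdges H edges

  open SignedSuperEdges public

  flip-sign : SignedSuperEdges → SignedSuperEdges
  flip-sign (signed c e sup) = signed (- c) e sup

  ∪-super : ∀ {e} S → IsSuperEdges H e → nonemptyB S ≡ true → IsSuperEdges H (e ∪｛ S ｝)
  ∪-super {e} S (e∅ , H⊆e) neS = trans (cong (_∨ (∅ ==ˢ S)) e∅) ∅≢S , λ T HT → cong (_∨ (T ==ˢ S)) (H⊆e T HT)
    where
    ∅≢S : (∅ ==ˢ S) ≡ false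
    ∅≢S = Boolₚ.¬-not λ ∅==S →
      Boolₚ.not-¬ neS (trans (cong nonemptyB (sym (==ˢ⇒≡ ∅ S ∅==S))) (nonemptyB-⊥ n))

  -- The edge sets e ∪ Z, for the sets Z of new nonempty subsets taken from Y, with sign (−1)^|Z|.
  extensions : (e : Subset n → Bool) → IsSuperEdges H e → List (Subset n) → List SignedSuperEdges
  extend : ∀ e → IsSuperEdges H e → ∀ S → List (Subset n) →
    Dec (e S ≡ false) → Dec (nonemptyB S ≡ true) → List SignedSuperEdges

  extensions e sup []      = signed 1ℚ e sup ∷ []
  extensions e sup (S ∷ Y) = extend e sup S Y (e S Boolₚ.≟ false) (nonemptyB S Boolₚ.≟ true)

  extend e sup S Y (yes _) (yes neS) =
    extensions e sup Y ++ map flip-sign (extensions (e ∪｛ S ｝) (∪-super S sup neS) Y)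
  extend e sup S Y _       _         = extensions e sup Y

  extensions-sign : ∀ e sup Y →
    All (λ s → sign s ≡ alternating (#edges (edges s)) * alternating (#edges e)) (extensions e sup Y)
  extensions-sign e sup []      = sym (alternating-square (#edges e)) ∷ []
  extensions-sign e sup (S ∷ Y) = extend-sign (e S Boolₚ.≟ false) (nonemptyB S Boolₚ.≟ true)
    where
    P : SignedSuperEdges → Set
    P s = sign s ≡ alternating (#edges (edges s)) * alternating (#edges e)
    extend-sign : ∀ e-S? ne-S? → All P (extend e sup S Y e-S? ne-S?)
    extend-sign (yes eS) (yes neS) =
      Allₚ.++⁺ (extensions-sign e sup Y)
               (Allₚ.gmap⁺ (λ {s} → flipped {s}) (extensions-sign (e ∪｛ S ｝) (∪-super S sup neS) Y))
      where
      flipped : ∀ {s} → sign s ≡ alternating (#edges (edges s)) * alternating (#edges (e ∪｛ S ｝)) →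
                - sign s ≡ alternating (#edges (edges s)) * alternating (#edges e)
      flipped {s} h = begin
        - sign s                                 ≡⟨ cong -_ h ⟩
        - (a * alternating (#edges (e ∪｛ S ｝)))  ≡⟨ cong (λ m → - (a * alternating m)) (#edges-∪ e S eS) ⟩
        - (a * - alternating (#edges e))         ≡⟨ cong -_ (sym (ℚₚ.neg-distribʳ-* a (alternating (#edges e)))) ⟩
        - (- (a * alternating (#edges e)))       ≡⟨ ℚ+Group.⁻¹-involutive (a * alternating (#edges e)) ⟩
        a * alternating (#edges e)               ∎
        where
        open ≡-Reasoning
        a = alternating (#edges (edges s))
    extend-sign (yes _) (no _) = extensions-sign e sup Y
    extend-sign (no _)  _      = extensions-sign e sup Y

  ⊆-∪-tail : ∀ {e e₀ : Subset n → Bool} {S Y} → (e₀ S ≡ true → e S ≡ true) →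
    (∀ T → e₀ T ≡ true → e T ≡ true ⊎ T ∈ S ∷ Y) → ∀ T → e₀ T ≡ true → e T ≡ true ⊎ T ∈ Y
  ⊆-∪-tail e₀S⇒eS e₀⊆e∪SY T e₀T with e₀⊆e∪SY T e₀T
  ... | inj₁ eT           = inj₁ eT
  ... | inj₂ (here refl)  = inj₁ (e₀S⇒eS e₀T)
  ... | inj₂ (there T∈Y)  = inj₂ T∈Y

  extensions-cover : ∀ e sup Y e₀ → e₀ ∅ ≡ false → (∀ T → e T ≡ true → e₀ T ≡ true) →
    (∀ T → e₀ T ≡ true → e T ≡ true ⊎ T ∈ Y) → Any (λ s → edges s ≗ e₀) (extensions e sup Y)
  extensions-cover e sup [] e₀ _ e⊆e₀ e₀⊆e∪Y =
    here λ T → ≡true-ext (e⊆e₀ T) λ e₀T → in-e (e₀⊆e∪Y T e₀T)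
    where
    in-e : ∀ {T} → e T ≡ true ⊎ T ∈ [] → e T ≡ true
    in-e (inj₁ eT) = eT
  extensions-cover e sup (S ∷ Y) e₀ e₀∅ e⊆e₀ e₀⊆e∪SY =
    extend-cover (e S Boolₚ.≟ false) (nonemptyB S Boolₚ.≟ true)
    where
    cover-Y : (e₀ S ≡ true → e S ≡ true) → Any (λ s → edges s ≗ e₀) (extensions e sup Y)
    cover-Y e₀S⇒eS = extensions-cover e sup Y e₀ e₀∅ e⊆e₀ (⊆-∪-tail e₀S⇒eS e₀⊆e∪SY)
    extend-cover : ∀ e-S? ne-S? → Any (λ s → edges s ≗ e₀) (extend e sup S Y e-S? ne-S?)
    extend-cover (no ¬eS)  _         = cover-Y (λ _ → Boolₚ.¬-not ¬eS)
    extend-cover (yes _)   (no ¬neS) = cover-Y λ e₀S →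
      ⊥-elim (Boolₚ.not-¬ e₀S (trans (cong e₀ (nonemptyB≡false⇒∅ {S = S} (Boolₚ.¬-not ¬neS))) e₀∅))
    extend-cover (yes _)   (yes neS) with e₀ S in e₀S
    ... | false = Anyₚ.++⁺ˡ (cover-Y λ e₀S′ → ⊥-elim (Boolₚ.not-¬ e₀S′ e₀S))
    ... | true  = Anyₚ.++⁺ʳ (extensions e sup Y) (Anyₚ.map⁺
                    (extensions-cover (e ∪｛ S ｝) (∪-super S sup neS) Y e₀ e₀∅ e∪S⊆e₀ (⊆-∪-tail S∈e∪S e₀⊆e∪S∪SY)))
      where
      e∪S⊆e₀ : ∀ T → e T ∨ (T ==ˢ S) ≡ true → e₀ T ≡ true
      e∪S⊆e₀ T h with e T in eT
      ... | true  = e⊆e₀ T eT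
      ... | false = subst (λ U → e₀ U ≡ true) (sym (==ˢ⇒≡ T S h)) e₀S
      S∈e∪S : e₀ S ≡ true → e S ∨ (S ==ˢ S) ≡ true
      S∈e∪S _ = trans (cong (e S ∨_) (==ˢ-refl S)) (Boolₚ.∨-zeroʳ (e S))
      e₀⊆e∪S∪SY : ∀ T → e₀ T ≡ true → e T ∨ (T ==ˢ S) ≡ true ⊎ T ∈ S ∷ Y
      e₀⊆e∪S∪SY T e₀T = Sum.map₁ (cong (_∨ (T ==ˢ S))) (e₀⊆e∪SY T e₀T)

  reflects : (G : Hypergraph) → (Subset n → Bool) → List (Subset n) → (Fin n → Fin (size G)) → Bool
  reflects G e Y φ = allL (λ S → edge G (image φ S) ⇒ᵇ e S) Y

  module _ (G : Hypergraph) (R : (Fin n → Fin (size G)) → Bool) where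

    #reflecting : (e : Subset n → Bool) → IsSuperEdges H e → List (Subset n) → ℕ
    #reflecting e sup Y =
      count (λ φ → R φ ∧ (isHom (superHG H e sup) G φ ∧ reflects G e Y φ)) (allMaps n (size G))

    #homs : (e : Subset n → Bool) → IsSuperEdges H e → ℕ
    #homs e sup = count (λ φ → R φ ∧ isHom (superHG H e sup) G φ) (allMaps n (size G))

    ∑-flip-sign : ∀ ss → ∑[ s ∈ map flip-sign ss ] sign s * ℕ→ℚ (#homs (edges s) (super s))
                         ≡ - (∑[ s ∈ ss ] sign s * ℕ→ℚ (#homs (edges s) (super s)))
    ∑-flip-sign ss = begin
      ∑[ s ∈ map flip-sign ss ] sign s * x s    ≡⟨ ∑-map flip-sign _ ss ⟩
      ∑[ s ∈ ss ] - sign s * x s                ≡⟨ ∑-cong (λ s → sym (ℚₚ.neg-distribˡ-* (sign s) (x s))) ss ⟩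
      ∑[ s ∈ ss ] - (sign s * x s)              ≡⟨ ∑-neg _ ss ⟩
      - (∑[ s ∈ ss ] sign s * x s)              ∎
      where
      open ≡-Reasoning
      x : SignedSuperEdges → ℚ
      x s = ℕ→ℚ (#homs (edges s) (super s))

    #reflecting-trivial : ∀ e sup S Y → (∀ φ → (edge G (image φ S) ⇒ᵇ e S) ≡ true) →
      #reflecting e sup (S ∷ Y) ≡ #reflecting e sup Y
    #reflecting-trivial e sup S Y trivial = count-cong
      (λ φ → cong (λ b → R φ ∧ (isHom (superHG H e sup) G φ ∧ (b ∧ reflects G e Y φ))) (trivial φ))
      (allMaps n (size G))

    #reflecting-split : ∀ e sup S Y → e S ≡ false → (neS : nonemptyB S ≡ true) → All (S ≢_) Y →
      #reflecting e sup Y ≡ #reflecting (e ∪｛ S ｝) (∪-super S sup neS) Y ℕ.+ #reflecting e sup (S ∷ Y)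
    #reflecting-split e sup S Y eS neS S∉Y = begin
      #reflecting e sup Y
        ≡⟨ count-split g P maps ⟩
      count (λ φ → g φ ∧ P φ) maps ℕ.+ count (λ φ → not (g φ) ∧ P φ) maps
        ≡⟨ cong₂ ℕ._+_ (count-cong with-S maps) (count-cong without-S maps) ⟩
      #reflecting (e ∪｛ S ｝) (∪-super S sup neS) Y ℕ.+ #reflecting e sup (S ∷ Y)
        ∎
      where
      open ≡-Reasoning
      open ∨-∧-Solver
      maps = allMaps n (size G)
      g h P : (Fin n → Fin (size G)) → Bool
      g φ = edge G (image φ S)
      h φ = isHom (superHG H e sup) G φ
      P φ = R φ ∧ (h φ ∧ reflects G e Y φ)
      reflects-∪ : ∀ φ → reflects G (e ∪｛ S ｝) Y φ ≡ reflects G e Y φ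
      reflects-∪ φ = allL-cong (All.map (λ {T} S≢T → cong (edge G (image φ T) ⇒ᵇ_)
        (trans (cong (e T ∨_) (Boolₚ.¬-not λ T==S → S≢T (sym (==ˢ⇒≡ T S T==S)))) (Boolₚ.∨-identityʳ (e T)))) S∉Y)
      with-S : ∀ φ → g φ ∧ P φ
                   ≡ R φ ∧ (isHom (superHG H (e ∪｛ S ｝) (∪-super S sup neS)) G φ ∧ reflects G (e ∪｛ S ｝) Y φ)
      with-S φ = begin
        g φ ∧ (R φ ∧ (h φ ∧ r))
          ≡⟨ solve 4 (λ g r h x → g :* (r :* (h :* x)) := r :* ((h :* g) :* x)) refl (g φ) (R φ) (h φ) r ⟩
        R φ ∧ ((h φ ∧ g φ) ∧ r)
          ≡⟨ cong₂ (λ a b → R φ ∧ (a ∧ b)) (sym (isHom-∪ e S (proj₁ sup) (proj₁ (∪-super S sup neS)) G φ))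
                                           (sym (reflects-∪ φ)) ⟩
        R φ ∧ (isHom (superHG H (e ∪｛ S ｝) (∪-super S sup neS)) G φ ∧ reflects G (e ∪｛ S ｝) Y φ)
          ∎
        where r = reflects G e Y φ
      without-S : ∀ φ → not (g φ) ∧ P φ ≡ R φ ∧ (h φ ∧ ((g φ ⇒ᵇ e S) ∧ reflects G e Y φ))
      without-S φ = begin
        not (g φ) ∧ (R φ ∧ (h φ ∧ r))
          ≡⟨ solve 4 (λ g r h x → g :* (r :* (h :* x)) := r :* (h :* (g :* x))) refl (not (g φ)) (R φ) (h φ) r ⟩
        R φ ∧ (h φ ∧ (not (g φ) ∧ r))
          ≡⟨ cong (λ b → R φ ∧ (h φ ∧ (b ∧ r))) (sym (trans (cong (g φ ⇒ᵇ_) eS) (Boolₚ.∨-identityʳ (not (g φ))))) ⟩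
        R φ ∧ (h φ ∧ ((g φ ⇒ᵇ e S) ∧ r))
          ∎
        where r = reflects G e Y φ

    count-extensions : ∀ e sup Y → Unique Y →
      ℕ→ℚ (#reflecting e sup Y) ≡ ∑[ s ∈ extensions e sup Y ] sign s * ℕ→ℚ (#homs (edges s) (super s))
    count-extensions e sup [] _ = begin
      ℕ→ℚ (#reflecting e sup [])     ≡⟨ cong ℕ→ℚ (count-cong (λ φ → cong (R φ ∧_) (Boolₚ.∧-identityʳ _))
                                                             (allMaps n (size G))) ⟩
      ℕ→ℚ (#homs e sup)              ≡⟨ sym (ℚₚ.*-identityˡ _) ⟩
      1ℚ * ℕ→ℚ (#homs e sup)         ≡⟨ sym (ℚₚ.+-identityʳ _) ⟩
      1ℚ * ℕ→ℚ (#homs e sup) + 0ℚ    ∎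
      where open ≡-Reasoning
    count-extensions e sup (S ∷ Y) (S∉Y ∷ Y-unique) =
      extend-count (e S Boolₚ.≟ false) (nonemptyB S Boolₚ.≟ true)
      where
      ∑ext : List SignedSuperEdges → ℚ
      ∑ext ss = ∑[ s ∈ ss ] sign s * ℕ→ℚ (#homs (edges s) (super s))
      extend-count : ∀ e-S? ne-S? → ℕ→ℚ (#reflecting e sup (S ∷ Y)) ≡ ∑ext (extend e sup S Y e-S? ne-S?)
      extend-count (yes eS) (yes neS) = begin
        ℕ→ℚ (#reflecting e sup (S ∷ Y))
          ≡⟨ ℕ→ℚ-difference (#reflecting e sup Y) (#reflecting (e ∪｛ S ｝) sup′ Y) (#reflecting e sup (S ∷ Y))
                            (#reflecting-split e sup S Y eS neS S∉Y) ⟩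
        ℕ→ℚ (#reflecting e sup Y) + - ℕ→ℚ (#reflecting (e ∪｛ S ｝) sup′ Y)
          ≡⟨ cong₂ (λ x y → x + - y) (count-extensions e sup Y Y-unique)
                                     (count-extensions (e ∪｛ S ｝) sup′ Y Y-unique) ⟩
        ∑ext (extensions e sup Y) + - ∑ext (extensions (e ∪｛ S ｝) sup′ Y)
          ≡⟨ cong (∑ext (extensions e sup Y) +_) (sym (∑-flip-sign (extensions (e ∪｛ S ｝) sup′ Y))) ⟩
        ∑ext (extensions e sup Y) + ∑ext (map flip-sign (extensions (e ∪｛ S ｝) sup′ Y))
          ≡⟨ sym (∑-++ _ (extensions e sup Y) _) ⟩
        ∑ext (extensions e sup Y ++ map flip-sign (extensions (e ∪｛ S ｝) sup′ Y))
          ∎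
        where
        open ≡-Reasoning
        sup′ = ∪-super S sup neS
      extend-count (yes _) (no ¬neS) =
        trans (cong ℕ→ℚ (#reflecting-trivial e sup S Y S-empty)) (count-extensions e sup Y Y-unique)
        where
        S-empty : ∀ φ → (edge G (image φ S) ⇒ᵇ e S) ≡ true
        S-empty φ = cong (_⇒ᵇ e S)
          (trans (cong (edge G ∘ image φ) (nonemptyB≡false⇒∅ {S = S} (Boolₚ.¬-not ¬neS)))
                 (trans (cong (edge G) (image-∅ φ)) (noEmpty G)))
      extend-count (no ¬eS) _ =
        trans (cong ℕ→ℚ (#reflecting-trivial e sup S Y S-edge)) (count-extensions e sup Y Y-unique)
        where
        S-edge : ∀ φ → (edge G (image φ S) ⇒ᵇ e S) ≡ true
        S-edge φ = trans (cong (edge G (image φ S) ⇒ᵇ_) (Boolₚ.¬-not ¬eS)) (Boolₚ.∨-zeroʳ _)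

-- Strong embeddings

isStrEmb≡ : ∀ H G φ →
  isStrEmb H G φ ≡ injectiveB φ ∧ (isHom H G φ ∧ reflects H G (edge H) (allSubsets (size H)) φ)
isStrEmb≡ H G φ = cong (injectiveB φ ∧_) (begin
  hom ∧ allSubsetsB (λ S → edge H S ⇔ᵇ g S)
    ≡⟨ cong (hom ∧_) (allL-cong (All.universal (λ S → ⇔ᵇ-as-⇒ᵇ (edge H S) (g S)) (allSubsets (size H)))) ⟩
  hom ∧ allSubsetsB (λ S → (edge H S ⇒ᵇ g S) ∧ (g S ⇒ᵇ edge H S))
    ≡⟨ cong (hom ∧_) (allL-∧ _ _ (allSubsets (size H))) ⟩
  hom ∧ (hom ∧ reflected)
    ≡⟨ sym (Boolₚ.∧-assoc hom hom reflected) ⟩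
  (hom ∧ hom) ∧ reflected
    ≡⟨ cong (_∧ reflected) (Boolₚ.∧-idem hom) ⟩
  hom ∧ reflected
    ∎)
  where
  open ≡-Reasoning
  g : Subset (size H) → Bool
  g S = edge G (image φ S)
  hom reflected : Bool
  hom = isHom H G φ
  reflected = reflects H G (edge H) (allSubsets (size H)) φ

#Hom-quotient : ∀ Y {k} (p : Fin (size Y) → Fin k) G → #Hom (quotient Y p) G ≡ #through (isHom Y G) p
#Hom-quotient Y p G = count-cong (isHom-quotient Y p G) (allMaps _ (size G))

record WeightedQuotient (H : Hypergraph) : Set where
  field
    coeff    : ℚ
    graph    : Hypergraph
    graph∈QS : InQS H graph
open WeightedQuotient public

isSuperEdges-refl : ∀ H → IsSuperEdges H (edge H)
isSuperEdges-refl H = noEmpty H , λ _ HS → HS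

module _ (H : Hypergraph) where

  private
    n = size H

  partitions : List (WeightedPartition n n)
  partitions = proj₁ (injective-expansion n)

  quotients-of : SignedSuperEdges H → List (WeightedQuotient H)
  quotients-of s = unquotiented ∷ map quotiented partitions
    where
    F = superHG H (edges s) (super s)
    unquotiented : WeightedQuotient H
    unquotiented = record
      { coeff = sign s ; graph = F
      ; graph∈QS = edges s , super s , n , id , Identity.surjective _≡_ , ≅-quotient-id F }
    quotiented : WeightedPartition n n → WeightedQuotient H
    quotiented t = record
      { coeff = sign s * weight t ; graph = quotient F (label t)
      ; graph∈QS = edges s , super s , blocks t , label t , label-surjective t , ≅-refl (quotient F (label t)) }

  quotients-of-expansion : ∀ G s →
    sign s * ℕ→ℚ (#homs H G injectiveB (edges s) (super s))
      ≡ ∑[ t ∈ quotients-of s ] coeff t * ℕ→ℚ (#Hom (graph t) G)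
  quotients-of-expansion G s = begin
    sign s * ℕ→ℚ (#homs H G injectiveB (edges s) (super s))
      ≡⟨ cong (sign s *_) (proj₂ (injective-expansion n) (isHom F G) (isHom-cong F G)) ⟩
    sign s * (ℕ→ℚ (#Hom F G) + weighted-count (isHom F G) partitions)
      ≡⟨ ℚₚ.*-distribˡ-+ (sign s) _ _ ⟩
    sign s * ℕ→ℚ (#Hom F G) + sign s * weighted-count (isHom F G) partitions
      ≡⟨ cong (sign s * ℕ→ℚ (#Hom F G) +_)
              (trans (*-distribˡ-∑ (sign s) _ partitions) (∑-cong reassociate partitions)) ⟩
    sign s * ℕ→ℚ (#Hom F G) + (∑[ t ∈ partitions ] (sign s * weight t) * ℕ→ℚ (#Hom (quotient F (label t)) G))
      ≡⟨ cong (sign s * ℕ→ℚ (#Hom F G) +_) (sym (∑-map _ _ partitions)) ⟩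
    ∑[ t ∈ quotients-of s ] coeff t * ℕ→ℚ (#Hom (graph t) G)
      ∎
    where
    open ≡-Reasoning
    F = superHG H (edges s) (super s)
    reassociate : ∀ t → sign s * (weight t * ℕ→ℚ (#through (isHom F G) (label t)))
                      ≡ (sign s * weight t) * ℕ→ℚ (#Hom (quotient F (label t)) G)
    reassociate t = trans (sym (ℚₚ.*-assoc (sign s) (weight t) _))
                          (cong (λ x → (sign s * weight t) * ℕ→ℚ x) (sym (#Hom-quotient F (label t) G)))

  signed-super-edges : List (SignedSuperEdges H)
  signed-super-edges = extensions H (edge H) (isSuperEdges-refl H) (allSubsets n)

  expansion : List (WeightedQuotient H)
  expansion = concatMap quotients-of signed-super-edges

  #StrEmb-expansion : ∀ G → ℕ→ℚ (#StrEmb H G) ≡ ∑[ t ∈ expansion ] coeff t * ℕ→ℚ (#Hom (graph t) G)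
  #StrEmb-expansion G = begin
    ℕ→ℚ (#StrEmb H G)
      ≡⟨ cong ℕ→ℚ (count-cong (isStrEmb≡ H G) (allMaps n (size G))) ⟩
    ℕ→ℚ (#reflecting H G injectiveB (edge H) (isSuperEdges-refl H) (allSubsets n))
      ≡⟨ count-extensions H G injectiveB (edge H) (isSuperEdges-refl H) (allSubsets n)
                          (enumerates⇒unique _≟ˢ_ (enumerates-allSubsets n)) ⟩
    ∑[ s ∈ signed-super-edges ] sign s * ℕ→ℚ (#homs H G injectiveB (edges s) (super s))
      ≡⟨ ∑-cong (quotients-of-expansion G) signed-super-edges ⟩
    ∑[ s ∈ signed-super-edges ] (∑[ t ∈ quotients-of s ] coeff t * ℕ→ℚ (#Hom (graph t) G))
      ≡⟨ sym (∑-concatMap quotients-of _ signed-super-edges) ⟩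
    ∑[ t ∈ expansion ] coeff t * ℕ→ℚ (#Hom (graph t) G)
      ∎
    where open ≡-Reasoning

  expansion-covers : ∀ e₀ sup₀ → Any (λ t → graph t ≅ superHG H e₀ sup₀) expansion
  expansion-covers e₀ sup₀ = Anyₚ.concat⁺ (Anyₚ.map⁺ (Any.map unquotiented-≅
    (extensions-cover H (edge H) (isSuperEdges-refl H) (allSubsets n) e₀ (proj₁ sup₀) (proj₂ sup₀)
                      λ T _ → inj₂ (∈-allSubsets T))))
    where
    unquotiented-≅ : ∀ {s} → edges s ≗ e₀ → Any (λ t → graph t ≅ superHG H e₀ sup₀) (quotients-of s)
    unquotiented-≅ {s} edges≗e₀ = here (≅-by-edges {e∅ = proj₁ (super s)} {e′∅ = proj₁ sup₀} edges≗e₀)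

  -- (−1)^|e₀| (−1)^|E(H)| = (−1)^(|e₀| − |E(H)|)
  σ : (Subset n → Bool) → ℚ
  σ e₀ = alternating (#edges e₀) * alternating (#edges (edge H))

  expansion-sign : ∀ e₀ sup₀ → All (λ t → graph t ≅ superHG H e₀ sup₀ → coeff t ≡ σ e₀) expansion
  expansion-sign e₀ sup₀ =
    Allₚ.concat⁺ (Allₚ.gmap⁺ (λ {s} → signs-of s)
                             (extensions-sign H (edge H) (isSuperEdges-refl H) (allSubsets n)))
    where
    F₀ = superHG H e₀ sup₀
    signs-of : ∀ s → sign s ≡ σ (edges s) → All (λ t → graph t ≅ F₀ → coeff t ≡ σ e₀) (quotients-of s)
    signs-of s sign≡ = unquotiented ∷ Allₚ.map⁺ (All.universal quotiented partitions)
      where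
      F = superHG H (edges s) (super s)
      unquotiented : F ≅ F₀ → sign s ≡ σ e₀
      unquotiented F≅F₀ =
        trans sign≡ (cong (λ m → alternating m * alternating (#edges (edge H))) (≅⇒#edges≡ {F} {F₀} F≅F₀))
      quotiented : ∀ t → quotient F (label t) ≅ F₀ → sign s * weight t ≡ σ e₀
      quotiented t F/t≅F₀ =
        ⊥-elim (ℕₚ.<-irrefl (≅⇒size≡ {quotient F (label t)} {F₀} F/t≅F₀) (blocks<k t))

lemma4p3 : (H : Hypergraph) (r : ℕ) (L : Fin r → Hypergraph) → IsRepSystem H r L →
    Σ (Fin r → ℚ) λ γ →
      (∀ (G : Hypergraph) → ℕ→ℚ (#StrEmb H G) ≡ sumℚ (λ i → γ i * ℕ→ℚ (#Hom (L i) G)))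
      × (∀ (e : Subset (size H) → Bool) (sup : IsSuperEdges H e) (i : Fin r) →
           superHG H e sup ≅ L i → γ i ≢ 0ℚ)
lemma4p3 H r L (_ , L-unique , L-complete) = γ , identity , nonzero
  where
  idx : WeightedQuotient H → Fin r
  idx t = proj₁ (L-complete (graph t) (graph∈QS t))
  graph≅L : ∀ t → graph t ≅ L (idx t)
  graph≅L t = proj₂ (L-complete (graph t) (graph∈QS t))
  γ : Fin r → ℚ
  γ i = ∑[ t ∈ expansion H ] (if idx t ==ᶠ i then coeff t else 0ℚ)
  identity : ∀ G → ℕ→ℚ (#StrEmb H G) ≡ sumℚ (λ i → γ i * ℕ→ℚ (#Hom (L i) G))
  identity G = begin
    ℕ→ℚ (#StrEmb H G)
      ≡⟨ #StrEmb-expansion H G ⟩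
    ∑[ t ∈ expansion H ] coeff t * ℕ→ℚ (#Hom (graph t) G)
      ≡⟨ ∑-cong (λ t → cong (λ m → coeff t * ℕ→ℚ m) (≅⇒#Hom≡ {graph t} {L (idx t)} (graph≅L t) G)) (expansion H) ⟩
    ∑[ t ∈ expansion H ] coeff t * ℕ→ℚ (#Hom (L (idx t)) G)
      ≡⟨ ∑-collect idx coeff (λ i → ℕ→ℚ (#Hom (L i) G)) (expansion H) ⟩
    sumℚ (λ i → γ i * ℕ→ℚ (#Hom (L i) G))
      ∎
    where open ≡-Reasoning
  nonzero : ∀ e sup i → superHG H e sup ≅ L i → γ i ≢ 0ℚ
  nonzero e sup i F≅Lᵢ = ∑-if-nonzero (λ t → idx t ==ᶠ i) coeff (σ H e) (expansion H)
    (alternating-product-square (#edges e) (#edges (edge H)))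
    (All.map (λ {t} sign≡ idx≡i → sign≡ (lands-on-F t (==ᶠ⇒≡ idx≡i))) (expansion-sign H e sup))
    (Any.map (λ {t} t≅F → dec-true (idx t Fin.≟ i) (lands-on-i t t≅F)) (expansion-covers H e sup))
    where
    F = superHG H e sup
    lands-on-F : ∀ t → idx t ≡ i → graph t ≅ F
    lands-on-F t refl = ≅-trans {graph t} {L i} {F} (graph≅L t) (≅-sym {F} {L i} F≅Lᵢ)
    lands-on-i : ∀ t → graph t ≅ F → idx t ≡ i
    lands-on-i t t≅F = L-unique (idx t) i
      (≅-trans {L (idx t)} {graph t} {L i} (≅-sym {graph t} {L (idx t)} (graph≅L t)) (≅-trans {graph t} {F} {L i} t≅F F≅Lᵢ))
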